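{- Let $k\ge2$, $q\ge1$ and let $F$ be a $(t-1)$-dimensional face of $T_{k,q}$. Then there exist a partition $\lambda=(\lambda_1,\ldots,\lambda_t)$ of $k$ into $t$ parts and, for each $i$, a partition $\sigma_i$ of $\lambda_i$, such that $\mathrm{link}_{T_{k,q}}(F)\cong K_{\sigma_1}*K_{\sigma_2}*\cdots*K_{\sigma_t}$; in this sense the link of $F$ corresponds to the pair $(\lambda,\{\sigma_1,\ldots,\sigma_t\})$ (the latter a multiset).
   Context: $R_{k,q}=\{\mathbf{x}\in\mathbb{R}^{k-1}:0\le x_1\le\cdots\le x_{k-1}\le q\}$, $W_{k,q}=R_{k,q}\cap\mathbb{Z}^{k-1}$. A permutation $\pi$ of $[k-1]$ is consistent with $\mathbf{v}\in W_{k,q}$ if $i$ precedes $i+1$ in $\pi$ whenever $v_i=v_{i+1}$; then $F(\mathbf{v},\pi)$ is the simplex with vertices $\mathbf{v}^{(1)}=\mathbf{v}$, $\mathbf{v}^{(m+1)}=\mathbf{v}^{(m)}+e_{\pi_{k-m}}$ ($m=1,\dots,k-1$). $T_{k,q}$ is the simplicial complex on $W_{k,q}$ whose facets are all such $F(\mathbf{v},\pi)$; $\mathrm{link}_K(\sigma)=\{\tau\in K:\sigma\cup\tau\in K,\sigma\cap\tau=\emptyset\}$. For a partition $\sigma=(\sigma_1,\ldots,\sigma_r)$ of $n$, $K_\sigma=\Delta(P_\sigma\setminus\{\hat0,\hat1\})$ where $P_\sigma=C_{\sigma_1}\times\cdots\times C_{\sigma_r}$, $C_m$ the chain $0<\cdots<m$;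 in particular $K_{(1)}=\{\emptyset\}$. $*$ denotes join. -}

module Defs where

open import Data.Nat using (ℕ; zero; suc; _+_; _∸_; _≤_; _<_; _≥_; _≤?_)
open import Data.Bool using (if_then_else_)
open import Data.Fin using (Fin; toℕ)
open import Data.Fin.Permutation using (Permutation′; _⟨$⟩ʳ_; _⟨$⟩ˡ_)
open import Data.Vec using (Vec; lookup; tabulate)
open import Data.Nat.ListAction using (sum)
open import Data.List using (List; []; _∷_; _++_; length; replicate; [_]; map)
open import Data.List.Relation.Unary.All using (All)
open import Data.List.Relation.Unary.Linked using (Linked)
open import Data.List.Relation.Binary.Pointwise using (Pointwise)
open import Data.List.Membership.Propositional using (_∈_; _∉_)
open import Data.Sum using (_⊎_; inj₁; inj₂)
open import Data.Product using (Σ; _×_)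
open import Data.Empty using (⊥)
open import Data.Unit using (⊤)
open import Relation.Nullary using (¬_)
open import Relation.Nullary.Decidable using (⌊_⌋)
open import Relation.Binary.PropositionalEquality using (_≡_; _≢_)

-- A complex has a vertex *type* V and a predicate `face` on finite lists
-- of elements of V; `face xs` means "the SET of entries of xs is a face".
-- (All concrete complexes below are defined so that `face` only depends
-- on the set of entries.)  The vertices of K are the v with face [ v ].

record Complex : Set₁ where
  field
    V    : Set
    face : List V → Set
open Complex public

record _≅_ (K L : Complex) : Set where
  field
    f      : V K → V L
    g      : V L → V K
    f-face : ∀ xs → face K xs → face L (map f xs)
    g-face : ∀ ys → face L ys → face K (map g ys)
    gf     : ∀ x → face K [ x ] → g (f x) ≡ x
    fg     : ∀ y → face L [ y ] → f (g y) ≡ y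

link : (K : Complex) → List (V K) → Complex
link K σ = record
  { V = V K
  ; face = λ τ → face K τ × face K (τ ++ σ) × All (λ x → x ∉ σ) τ }

lefts : {A B : Set} → List (A ⊎ B) → List A
lefts []            = []
lefts (inj₁ a ∷ xs) = a ∷ lefts xs
lefts (inj₂ _ ∷ xs) = lefts xs

rights : {A B : Set} → List (A ⊎ B) → List B
rights []            = []
rights (inj₁ _ ∷ xs) = rights xs
rights (inj₂ b ∷ xs) = b ∷ rights xs

_*_ : Complex → Complex → Complex
K * L = record
  { V = V K ⊎ V L
  ; face = λ xs → face K (lefts xs) × face L (rights xs) }

emptyFaceComplex : Complex
emptyFaceComplex = record { V = ⊥ ; face = λ _ → ⊤ }

joinAll : List Complex → Complex
joinAll []       = emptyFaceComplex
joinAll (K ∷ Ks) = K * joinAll Ks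

IsPartition : ℕ → List ℕ → Set
IsPartition n p = All (λ x → 1 ≤ x) p × Linked _≥_ p × sum p ≡ n

-- K_σ = Δ(P_σ ∖ {0̂,1̂}), P_σ = C_{σ₁} × ⋯ × C_{σ_r}.
-- Elements of P_σ: lists x with x_j ≤ σ_j; order componentwise.

_≼_ : List ℕ → List ℕ → Set
x ≼ y = Pointwise _≤_ x y

ProperElem : List ℕ → List ℕ → Set
ProperElem σ x = x ≼ σ × x ≢ replicate (length σ) 0 × x ≢ σ

Kσ : List ℕ → Complex
Kσ σ = record
  { V = List ℕ
  ; face = λ xs → All (ProperElem σ) xs
                 × (∀ {x y} → x ∈ xs → y ∈ xs → (x ≼ y) ⊎ (y ≼ x)) }

-- T_{k,q}, with n = k - 1; points are vectors in ℕ^n.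

module _ {n : ℕ} where

  InW : ℕ → Vec ℕ n → Set
  InW q x = (∀ (i j : Fin n) → toℕ i ≤ toℕ j → lookup x i ≤ lookup x j)
          × (∀ i → lookup x i ≤ q)

  -- π is the sequence π_1 … π_n with π_p = π ⟨$⟩ʳ p; the position of
  -- the value i in that sequence is π ⟨$⟩ˡ i.
  pos : Permutation′ n → Fin n → Fin n
  pos π i = π ⟨$⟩ˡ i

  Consistent : Vec ℕ n → Permutation′ n → Set
  Consistent v π = ∀ (i j : Fin n) → toℕ j ≡ suc (toℕ i) →
                   lookup v i ≡ lookup v j → toℕ (pos π i) < toℕ (pos π j)

  -- vert v π m = v^{(m+1)} = v + e_{π_n} + e_{π_{n-1}} + ⋯ + e_{π_{n-m+1}}
  -- (0 ≤ m ≤ n); coordinate i is raised iff its (0-based) position ≥ n - m.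
  vert : Vec ℕ n → Permutation′ n → ℕ → Vec ℕ n
  vert v π m = tabulate λ i →
    lookup v i + (if ⌊ n ∸ m ≤? toℕ (pos π i) ⌋ then 1 else 0)

  IsVertexOf : Vec ℕ n → Permutation′ n → Vec ℕ n → Set
  IsVertexOf v π x = Σ ℕ λ m → m ≤ n × x ≡ vert v π m

  IsFacet : ℕ → Vec ℕ n → Permutation′ n → Set
  IsFacet q v π = InW q v × Consistent v π × (∀ m → m ≤ n → InW q (vert v π m))

T : (k q : ℕ) → Complex
T k q = record
  { V = Vec ℕ (k ∸ 1)
  ; face = λ xs → Σ (Vec ℕ (k ∸ 1)) λ v → Σ (Permutation′ (k ∸ 1)) λ π →
                  IsFacet q v π × All (IsVertexOf v π) xs }

{-# OPTIONS --safe #-}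

-- Both complexes are flag complexes.  K_σ is the flag complex of the comparability graph of the proper part of
-- P_σ, and T_{k,q} (n = k - 1) is the flag complex of the graph on W_{k,q} joining x and y when x ≤ y ≤ x + 1
-- coordinatewise or vice versa: every clique of that graph lies in a facet F(v, π).  In a flag complex the link
-- of a face is the flag complex of the common neighbourhood, so links can be taken one vertex at a time.  The
-- link of a vertex x of T_{k,q} is K_μ, where μ lists how often each value 0, …, q - 1 occurs in (0, x) once the
-- entries equal to q are rotated to the front and lowered to 0; μ sums to k.  The link of a vertex c of K_s is
-- K_c * K_{s - c}.  So the link of a (t - 1)-face is a join of t complexes K_σ whose parts sum to k, and deleting
-- zero parts and sorting turns the sizes into the partition λ and each σ into a partition of λ_i.

module Submission where

open import Defs
import Data.Nat as ℕ
open import Data.Nat using (_<?_; _<ᵇ_; ℕ; zero; suc; _+_; _∸_; _⊓_; _≡ᵇ_; _≤_; _<_; _≥_; z≤n; s≤s; _≤?_)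
open import Data.Nat.Properties using (pred-mono-≤; ≤⇒≯; <⇒≱; m+n∸m≡n; m∸n≤m; *-monoˡ-≤; ∸-monoʳ-<; <-cmp; <⇒≢; <-asym; ≮⇒≥; <-irrefl; <-trans; <ᵇ⇒<; <⇒<ᵇ; m≤n⇒m<n∨m≡n; ∸-cancelˡ-≡; +-cancelˡ-≡; m⊓n≤m; m⊓n≤n; ⊓-glb; ⊓-sel; ≡ᵇ⇒≡; ≡⇒≡ᵇ; ≤∧≢⇒<; ≤-total; m≤m+n; ∸-monoʳ-≤; +-monoʳ-≤; +-identityʳ; ≤-reflexive; 1+n≰n; ≤-pred; n≤1+n; +-suc; +-mono-≤; +-monoʳ-<; module ≤-Reasoning; +-comm; +-assoc; +-commutativeSemigroup; <⇒≤; ≰⇒>; ≤-refl; ≤-trans; ≤-antisym; m∸n+n≡m; m+n∸n≡m; n∸n≡0; +-monoˡ-≤; ∸-monoˡ-≤; m≤n+m; suc-injective)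
open import Data.Nat.ListAction using (sum)
open import Data.Nat.ListAction.Properties using (sum-↭)
open import Algebra.Properties.CommutativeSemigroup +-commutativeSemigroup using (interchange)
open import Data.Fin as Fin using (Fin)
import Data.Fin.Properties as Finₚ
open import Data.Fin.Properties using (punchOut-injective; injective⇒≤)
open import Data.Fin.Permutation using (Permutation′; permutation; _⟨$⟩ˡ_)
import Data.Vec as Vec
open import Data.Vec using (Vec; []; _∷_; lookup; toList; tabulate)
import Data.Vec.Relation.Unary.All.Properties as VecAll
open import Data.Vec.Properties using (toList-map; toList∘fromList; lookup-map; length-toList; lookup∘tabulate; tabulate∘lookup; tabulate-cong)
import Data.List as List
open import Data.List using (List; []; _∷_; _++_; [_]; length; map; replicate; zipWith; take; drop; allFin)
open import Data.List.Properties using (map-tabulate; length-++; map-++; map-replicate; length-replicate; ∷-injectiveˡ; ∷-injectiveʳ; map-id; map-∘; length-map; length-tabulate)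
open import Data.List.Relation.Unary.All as All using (All; []; _∷_)
import Data.List.Relation.Unary.All.Properties as Allₚ
open import Data.List.Relation.Unary.Any using (here; there)
open import Data.List.Relation.Unary.Linked as Linked using (Linked; []; [-]; _∷_)
import Data.List.Relation.Unary.Linked.Properties as Linkedₚ
open import Data.List.Relation.Unary.Linked.Properties using (Linked⇒All)
open import Data.List.Relation.Binary.Pointwise as Pointwise using (Pointwise; []; _∷_; Pointwise-length)
open import Data.List.Relation.Unary.Unique.Propositional using (Unique)
open import Data.List.Relation.Unary.AllPairs using (_∷_)
open import Data.List.Membership.Propositional using (_∈_; _∉_)
open import Data.List.Membership.Propositional.Properties using (∈-allFin; ∈-map⁺; ∈-map⁻; ∈-++⁺ˡ; ∈-++⁺ʳ; ∈-++⁻)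
open import Data.Sum as Sum using (_⊎_; inj₁; inj₂)
open import Data.Product as Product using (Σ; _×_; _,_; proj₁; proj₂; ∃)
open import Data.List.Relation.Binary.Permutation.Propositional as ↭ using (_↭_; ↭-sym)
open import Data.List.Relation.Binary.Permutation.Propositional.Properties as ↭ₚ using (↭-sym-involutive; All-resp-↭; ↭-length)
open import Data.Bool using (Bool; true; false; not; _∨_; if_then_else_) renaming (T to Tᵇ)
open import Data.Empty using (⊥; ⊥-elim)
open import Data.Unit using (⊤; tt)
open import Function using (_∘_)
open import Relation.Nullary using (¬_; Dec; yes; no)
open import Relation.Nullary.Decidable using (⌊_⌋; T?; toWitness; fromWitness)
open import Relation.Binary.Definitions using (tri<; tri≈; tri>)
open import Relation.Binary.PropositionalEquality using (_≡_; _≢_; module ≡-Reasoning; refl; sym; trans; cong; cong₂; subst; subst₂)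

-- Flag complexes of graphs

record Graph : Set₁ where
  field
    Carrier : Set
    Vtx     : Carrier → Set
    Adj     : Carrier → Carrier → Set
open Graph public

Flag : Graph → Complex
Flag G = record
  { V = Carrier G
  ; face = λ xs → All (Vtx G) xs × (∀ {x y} → x ∈ xs → y ∈ xs → Adj G x y) }

record _≃_ (G H : Graph) : Set where
  field
    f     : Carrier G → Carrier H
    g     : Carrier H → Carrier G
    f-vtx : ∀ {x} → Vtx G x → Vtx H (f x)
    g-vtx : ∀ {y} → Vtx H y → Vtx G (g y)
    f-adj : ∀ {x y} → Vtx G x → Vtx G y → Adj G x y → Adj H (f x) (f y)
    g-adj : ∀ {x y} → Vtx H x → Vtx H y → Adj H x y → Adj G (g x) (g y)
    gf    : ∀ {x} → Vtx G x → g (f x) ≡ x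
    fg    : ∀ {y} → Vtx H y → f (g y) ≡ y

infix 4 _≃_

≃-refl : ∀ {G} → G ≃ G
≃-refl = record
  { f = λ x → x ; g = λ x → x ; f-vtx = λ p → p ; g-vtx = λ p → p
  ; f-adj = λ _ _ r → r ; g-adj = λ _ _ r → r ; gf = λ _ → refl ; fg = λ _ → refl }

≃-sym : ∀ {G H} → G ≃ H → H ≃ G
≃-sym φ = record
  { f = g ; g = f ; f-vtx = g-vtx ; g-vtx = f-vtx ; f-adj = g-adj ; g-adj = f-adj ; gf = fg ; fg = gf }
  where open _≃_ φ

≃-trans : ∀ {G H K} → G ≃ H → H ≃ K → G ≃ K
≃-trans φ ψ = record
  { f = λ x → ψ.f (φ.f x) ; g = λ z → φ.g (ψ.g z)
  ; f-vtx = λ p → ψ.f-vtx (φ.f-vtx p) ; g-vtx = λ p → φ.g-vtx (ψ.g-vtx p)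
  ; f-adj = λ px py r → ψ.f-adj (φ.f-vtx px) (φ.f-vtx py) (φ.f-adj px py r)
  ; g-adj = λ px py r → φ.g-adj (ψ.g-vtx px) (ψ.g-vtx py) (ψ.g-adj px py r)
  ; gf = λ p → trans (cong φ.g (ψ.gf (φ.f-vtx p))) (φ.gf p)
  ; fg = λ p → trans (cong ψ.f (φ.fg (ψ.g-vtx p))) (ψ.fg p) }
  where
  module φ = _≃_ φ
  module ψ = _≃_ ψ

≅-refl : ∀ {K} → K ≅ K
≅-refl {K} = record
  { f = λ x → x ; g = λ x → x
  ; f-face = λ xs p → subst (face K) (sym (map-id xs)) p
  ; g-face = λ xs p → subst (face K) (sym (map-id xs)) p
  ; gf = λ _ _ → refl ; fg = λ _ _ → refl }

≅-sym : ∀ {K L} → K ≅ L → L ≅ K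
≅-sym φ = record { f = g ; g = f ; f-face = g-face ; g-face = f-face ; gf = fg ; fg = gf }
  where open _≅_ φ

≅-trans : ∀ {K L M} → K ≅ L → L ≅ M → K ≅ M
≅-trans {K} {L} {M} φ ψ = record
  { f = λ x → ψ.f (φ.f x) ; g = λ z → φ.g (ψ.g z)
  ; f-face = λ xs p → subst (face M) (sym (map-∘ xs)) (ψ.f-face _ (φ.f-face xs p))
  ; g-face = λ xs p → subst (face K) (sym (map-∘ xs)) (φ.g-face _ (ψ.g-face xs p))
  ; gf = λ x p → trans (cong φ.g (ψ.gf (φ.f x) (φ.f-face [ x ] p))) (φ.gf x p)
  ; fg = λ z p → trans (cong ψ.f (φ.fg (ψ.g z) (ψ.g-face [ z ] p))) (ψ.fg z p) }
  where
  module φ = _≅_ φ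
  module ψ = _≅_ ψ

≅-sameFaces : ∀ {A : Set} (φ ψ : List A → Set) → (∀ xs → φ xs → ψ xs) → (∀ xs → ψ xs → φ xs) →
              record { V = A ; face = φ } ≅ record { V = A ; face = ψ }
≅-sameFaces φ ψ to from = record
  { f = λ x → x ; g = λ x → x
  ; f-face = λ xs p → subst ψ (sym (map-id xs)) (to xs p)
  ; g-face = λ xs p → subst φ (sym (map-id xs)) (from xs p)
  ; gf = λ _ _ → refl ; fg = λ _ _ → refl }

Flag-cong : ∀ {G H} → G ≃ H → Flag G ≅ Flag H
Flag-cong {G} {H} φ = record
  { f = f ; g = g
  ; f-face = λ xs (vs , as) → Allₚ.map⁺ (All.map f-vtx vs) , map-adj f f-adj vs as
  ; g-face = λ xs (vs , as) → Allₚ.map⁺ (All.map g-vtx vs) , map-adj g g-adj vs as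
  ; gf = λ x (vs , _) → gf (All.head vs)
  ; fg = λ y (vs , _) → fg (All.head vs) }
  where
  open _≃_ φ
  map-adj : ∀ {A B : Set} {P : A → Set} {R : A → A → Set} {R′ : B → B → Set} (h : A → B) →
            (∀ {x y} → P x → P y → R x y → R′ (h x) (h y)) → ∀ {xs} → All P xs →
            (∀ {x y} → x ∈ xs → y ∈ xs → R x y) → ∀ {x y} → x ∈ map h xs → y ∈ map h xs → R′ x y
  map-adj h h-adj ps rs x∈ y∈ with ∈-map⁻ h x∈ | ∈-map⁻ h y∈
  ... | a , a∈ , refl | b , b∈ , refl = h-adj (All.lookup ps a∈) (All.lookup ps b∈) (rs a∈ b∈)

sumAdj : ∀ {A B : Set} → (A → A → Set) → (B → B → Set) → A ⊎ B → A ⊎ B → Set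
sumAdj R S (inj₁ a) (inj₁ b) = R a b
sumAdj R S (inj₂ a) (inj₂ b) = S a b
sumAdj R S _        _        = ⊤

_⊕_ : Graph → Graph → Graph
G ⊕ H = record { Carrier = Carrier G ⊎ Carrier H ; Vtx = Sum.[ Vtx G , Vtx H ] ; Adj = sumAdj (Adj G) (Adj H) }

infixr 5 _⊕_

∅ᴳ : Graph
∅ᴳ = record { Carrier = ⊥ ; Vtx = λ _ → ⊤ ; Adj = λ _ _ → ⊤ }

⨁ : List Graph → Graph
⨁ []       = ∅ᴳ
⨁ (G ∷ Gs) = G ⊕ ⨁ Gs

module _ {A B : Set} where

  ∈-lefts⁻ : ∀ {a : A} {xs : List (A ⊎ B)} → a ∈ lefts xs → inj₁ a ∈ xs
  ∈-lefts⁻ {xs = inj₁ x ∷ xs} (here refl) = here refl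
  ∈-lefts⁻ {xs = inj₁ x ∷ xs} (there p)   = there (∈-lefts⁻ p)
  ∈-lefts⁻ {xs = inj₂ y ∷ xs} p           = there (∈-lefts⁻ p)

  ∈-rights⁻ : ∀ {b : B} {xs : List (A ⊎ B)} → b ∈ rights xs → inj₂ b ∈ xs
  ∈-rights⁻ {xs = inj₂ x ∷ xs} (here refl) = here refl
  ∈-rights⁻ {xs = inj₂ x ∷ xs} (there p)   = there (∈-rights⁻ p)
  ∈-rights⁻ {xs = inj₁ y ∷ xs} p           = there (∈-rights⁻ p)

  ∈-lefts⁺ : ∀ {a : A} {xs : List (A ⊎ B)} → inj₁ a ∈ xs → a ∈ lefts xs
  ∈-lefts⁺ {xs = inj₁ x ∷ xs} (here refl) = here refl
  ∈-lefts⁺ {xs = inj₁ x ∷ xs} (there p)   = there (∈-lefts⁺ p)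
  ∈-lefts⁺ {xs = inj₂ y ∷ xs} (there p)   = ∈-lefts⁺ p

  ∈-rights⁺ : ∀ {b : B} {xs : List (A ⊎ B)} → inj₂ b ∈ xs → b ∈ rights xs
  ∈-rights⁺ {xs = inj₂ x ∷ xs} (here refl) = here refl
  ∈-rights⁺ {xs = inj₂ x ∷ xs} (there p)   = there (∈-rights⁺ p)
  ∈-rights⁺ {xs = inj₁ y ∷ xs} (there p)   = ∈-rights⁺ p

  All-lefts-rights⁻ : ∀ {P : A → Set} {Q : B → Set} {xs} → All Sum.[ P , Q ] xs → All P (lefts xs) × All Q (rights xs)
  All-lefts-rights⁻ {xs = []}         []       = [] , []
  All-lefts-rights⁻ {xs = inj₁ x ∷ xs} (p ∷ ps) = p ∷ proj₁ (All-lefts-rights⁻ ps) , proj₂ (All-lefts-rights⁻ ps)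
  All-lefts-rights⁻ {xs = inj₂ x ∷ xs} (p ∷ ps) = proj₁ (All-lefts-rights⁻ ps) , p ∷ proj₂ (All-lefts-rights⁻ ps)

  All-lefts-rights⁺ : ∀ {P : A → Set} {Q : B → Set} {xs} → All P (lefts xs) → All Q (rights xs) → All Sum.[ P , Q ] xs
  All-lefts-rights⁺ {xs = []}          _        _        = []
  All-lefts-rights⁺ {xs = inj₁ x ∷ xs} (p ∷ ps) qs       = p ∷ All-lefts-rights⁺ ps qs
  All-lefts-rights⁺ {xs = inj₂ x ∷ xs} ps       (q ∷ qs) = q ∷ All-lefts-rights⁺ ps qs

  lefts-map : ∀ {C D : Set} (h : A → C) (k : B → D) xs → lefts (map (Sum.map h k) xs) ≡ map h (lefts xs)
  lefts-map h k []            = refl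
  lefts-map h k (inj₁ a ∷ xs) = cong (h a ∷_) (lefts-map h k xs)
  lefts-map h k (inj₂ b ∷ xs) = lefts-map h k xs

  rights-map : ∀ {C D : Set} (h : A → C) (k : B → D) xs → rights (map (Sum.map h k) xs) ≡ map k (rights xs)
  rights-map h k []            = refl
  rights-map h k (inj₁ a ∷ xs) = rights-map h k xs
  rights-map h k (inj₂ b ∷ xs) = cong (k b ∷_) (rights-map h k xs)

Flag-⊕ : ∀ G H → (Flag G * Flag H) ≅ Flag (G ⊕ H)
Flag-⊕ G H = ≅-sameFaces _ _ to from
  where
  to : ∀ xs → face (Flag G * Flag H) xs → face (Flag (G ⊕ H)) xs
  to xs ((vl , al) , (vr , ar)) = All-lefts-rights⁺ vl vr , adj
    where
    adj : ∀ {x y} → x ∈ xs → y ∈ xs → Adj (G ⊕ H) x y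
    adj {inj₁ a} {inj₁ b} p q = al (∈-lefts⁺ p) (∈-lefts⁺ q)
    adj {inj₁ a} {inj₂ b} p q = tt
    adj {inj₂ a} {inj₁ b} p q = tt
    adj {inj₂ a} {inj₂ b} p q = ar (∈-rights⁺ p) (∈-rights⁺ q)
  from : ∀ xs → face (Flag (G ⊕ H)) xs → face (Flag G * Flag H) xs
  from xs (vs , as) = (proj₁ (All-lefts-rights⁻ vs) , λ p q → as (∈-lefts⁻ p) (∈-lefts⁻ q))
                    , (proj₂ (All-lefts-rights⁻ vs) , λ p q → as (∈-rights⁻ p) (∈-rights⁻ q))

Flag-∅ : emptyFaceComplex ≅ Flag ∅ᴳ
Flag-∅ = ≅-sameFaces _ _ (λ { [] _ → [] , (λ ()) ; (() ∷ _) _ }) (λ _ _ → tt)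

*-cong : ∀ {K K′ L L′} → K ≅ K′ → L ≅ L′ → (K * L) ≅ (K′ * L′)
*-cong {K} {K′} {L} {L′} φ ψ = record
  { f = Sum.map φ.f ψ.f ; g = Sum.map φ.g ψ.g
  ; f-face = λ xs (pl , pr) → subst (face K′) (sym (lefts-map φ.f ψ.f xs)) (φ.f-face _ pl)
                            , subst (face L′) (sym (rights-map φ.f ψ.f xs)) (ψ.f-face _ pr)
  ; g-face = λ xs (pl , pr) → subst (face K) (sym (lefts-map φ.g ψ.g xs)) (φ.g-face _ pl)
                            , subst (face L) (sym (rights-map φ.g ψ.g xs)) (ψ.g-face _ pr)
  ; gf = λ { (inj₁ a) (p , _) → cong inj₁ (φ.gf a p) ; (inj₂ b) (_ , p) → cong inj₂ (ψ.gf b p) }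
  ; fg = λ { (inj₁ a) (p , _) → cong inj₁ (φ.fg a p) ; (inj₂ b) (_ , p) → cong inj₂ (ψ.fg b p) } }
  where
  module φ = _≅_ φ
  module ψ = _≅_ ψ

joinAll-Flag : ∀ Gs → joinAll (map Flag Gs) ≅ Flag (⨁ Gs)
joinAll-Flag []       = Flag-∅
joinAll-Flag (G ∷ Gs) = ≅-trans (*-cong (≅-refl {Flag G}) (joinAll-Flag Gs)) (Flag-⊕ G (⨁ Gs))

linkᴳ : (G : Graph) → List (Carrier G) → Graph
linkᴳ G F = record
  { Carrier = Carrier G
  ; Vtx = λ y → Vtx G y × y ∉ F × All (λ z → Adj G y z × Adj G z y) F
  ; Adj = Adj G }

link-Flag : ∀ G F → face (Flag G) F → link (Flag G) F ≅ Flag (linkᴳ G F)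
link-Flag G F (vF , aF) = ≅-sameFaces _ _ to from
  where
  to : ∀ xs → face (link (Flag G) F) xs → face (Flag (linkᴳ G F)) xs
  to xs ((vs , as) , (_ , axsF) , xs∉F) =
    All.tabulate (λ {x} x∈ → All.lookup vs x∈ , All.lookup xs∉F x∈
                            , All.tabulate (λ z∈ → axsF (∈-++⁺ˡ x∈) (∈-++⁺ʳ xs z∈) , axsF (∈-++⁺ʳ xs z∈) (∈-++⁺ˡ x∈)))
    , as
  from : ∀ xs → face (Flag (linkᴳ G F)) xs → face (link (Flag G) F) xs
  from xs (vs , as) = (All.map proj₁ vs , as) , (Allₚ.++⁺ (All.map proj₁ vs) vF , adj) , All.map (λ v → proj₁ (proj₂ v)) vs
    where
    adj : ∀ {x y} → x ∈ xs ++ F → y ∈ xs ++ F → Adj G x y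
    adj x∈ y∈ with ∈-++⁻ xs x∈ | ∈-++⁻ xs y∈
    ... | inj₁ a | inj₁ b = as a b
    ... | inj₁ a | inj₂ b = proj₁ (All.lookup (proj₂ (proj₂ (All.lookup vs a))) b)
    ... | inj₂ a | inj₁ b = proj₂ (All.lookup (proj₂ (proj₂ (All.lookup vs b))) a)
    ... | inj₂ a | inj₂ b = aF a b

∉-[_] : ∀ {A : Set} {x c : A} → x ≢ c → x ∉ [ c ]
∉-[ x≢c ] (here x≡c) = x≢c x≡c

linkᴳ-∷ : ∀ G F c → linkᴳ (linkᴳ G F) [ c ] ≃ linkᴳ G (c ∷ F)
linkᴳ-∷ G F c = record
  { f = λ x → x ; g = λ x → x
  ; f-vtx = λ { ((p , x∉F , a) , x∉c , r ∷ []) → p , (λ { (here e) → x∉c (here e) ; (there x∈F) → x∉F x∈F }) , r ∷ a }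
  ; g-vtx = λ { (p , x∉cF , r ∷ a) → (p , (λ x∈F → x∉cF (there x∈F)) , a) , ∉-[ (λ e → x∉cF (here e)) ] , r ∷ [] }
  ; f-adj = λ _ _ r → r ; g-adj = λ _ _ r → r ; gf = λ _ → refl ; fg = λ _ → refl }

linkᴳ-cong : ∀ {G H} (φ : G ≃ H) F → All (Vtx G) F → linkᴳ G F ≃ linkᴳ H (map (_≃_.f φ) F)
linkᴳ-cong {G} {H} φ F vF = record
  { f = f ; g = g
  ; f-vtx = λ (p , y∉F , a) → f-vtx p , f-∉ p y∉F , Allₚ.map⁺ (f-adjacentToAll p vF a)
  ; g-vtx = λ (p , y∉fF , a) → g-vtx p , g-∉ p y∉fF , g-adjacentToAll p vF (Allₚ.map⁻ a)
  ; f-adj = λ px py r → f-adj (proj₁ px) (proj₁ py) r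
  ; g-adj = λ px py r → g-adj (proj₁ px) (proj₁ py) r
  ; gf = λ p → gf (proj₁ p) ; fg = λ p → fg (proj₁ p) }
  where
  open _≃_ φ
  f-∉ : ∀ {y} → Vtx G y → y ∉ F → f y ∉ map f F
  f-∉ p y∉F fy∈ with ∈-map⁻ f fy∈
  ... | z , z∈ , fy≡fz = y∉F (subst (_∈ F) (trans (sym (gf (All.lookup vF z∈))) (trans (cong g (sym fy≡fz)) (gf p))) z∈)
  g-∉ : ∀ {y} → Vtx H y → y ∉ map f F → g y ∉ F
  g-∉ p y∉fF gy∈ = y∉fF (subst (_∈ map f F) (fg p) (∈-map⁺ f gy∈))
  f-adjacentToAll : ∀ {y} → Vtx G y → ∀ {Z} → All (Vtx G) Z → All (λ z → Adj G y z × Adj G z y) Z →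
                    All (λ z → Adj H (f y) (f z) × Adj H (f z) (f y)) Z
  f-adjacentToAll p []       []              = []
  f-adjacentToAll p (q ∷ qs) ((r , r′) ∷ rs) = (f-adj p q r , f-adj q p r′) ∷ f-adjacentToAll p qs rs
  g-adjacentToAll : ∀ {y} → Vtx H y → ∀ {Z} → All (Vtx G) Z → All (λ z → Adj H y (f z) × Adj H (f z) y) Z →
                    All (λ z → Adj G (g y) z × Adj G z (g y)) Z
  g-adjacentToAll p []       []              = []
  g-adjacentToAll {y} p (q ∷ qs) ((r , r′) ∷ rs) =
    (subst (Adj G (g y)) (gf q) (g-adj p (f-vtx q) r) , subst (λ w → Adj G w (g y)) (gf q) (g-adj (f-vtx q) p r′))
    ∷ g-adjacentToAll p qs rs

linkᴳ-⊕ˡ : ∀ G H a → linkᴳ (G ⊕ H) [ inj₁ a ] ≃ linkᴳ G [ a ] ⊕ H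
linkᴳ-⊕ˡ G H a = record
  { f = λ x → x ; g = λ x → x
  ; f-vtx = λ { {inj₁ y} (p , y∉ , r ∷ []) → p , ∉-[ (λ { refl → y∉ (here refl) }) ] , r ∷ []
              ; {inj₂ y} (p , _ , _) → p }
  ; g-vtx = λ { {inj₁ y} (p , y∉ , r ∷ []) → p , ∉-[ (λ { refl → y∉ (here refl) }) ] , r ∷ []
              ; {inj₂ y} p → p , ∉-[ (λ ()) ] , (tt , tt) ∷ [] }
  ; f-adj = λ _ _ r → r ; g-adj = λ _ _ r → r ; gf = λ _ → refl ; fg = λ _ → refl }

linkᴳ-⊕ʳ : ∀ G H b → linkᴳ (G ⊕ H) [ inj₂ b ] ≃ G ⊕ linkᴳ H [ b ]
linkᴳ-⊕ʳ G H b = record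
  { f = λ x → x ; g = λ x → x
  ; f-vtx = λ { {inj₂ y} (p , y∉ , r ∷ []) → p , ∉-[ (λ { refl → y∉ (here refl) }) ] , r ∷ []
              ; {inj₁ y} (p , _ , _) → p }
  ; g-vtx = λ { {inj₂ y} (p , y∉ , r ∷ []) → p , ∉-[ (λ { refl → y∉ (here refl) }) ] , r ∷ []
              ; {inj₁ y} p → p , ∉-[ (λ ()) ] , (tt , tt) ∷ [] }
  ; f-adj = λ _ _ r → r ; g-adj = λ _ _ r → r ; gf = λ _ → refl ; fg = λ _ → refl }

⊕-cong : ∀ {G G′ H H′} → G ≃ G′ → H ≃ H′ → G ⊕ H ≃ G′ ⊕ H′
⊕-cong φ ψ = record
  { f = Sum.map φ.f ψ.f ; g = Sum.map φ.g ψ.g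
  ; f-vtx = λ { {inj₁ a} p → φ.f-vtx p ; {inj₂ b} p → ψ.f-vtx p }
  ; g-vtx = λ { {inj₁ a} p → φ.g-vtx p ; {inj₂ b} p → ψ.g-vtx p }
  ; f-adj = λ { {inj₁ a} {inj₁ b} p q r → φ.f-adj p q r ; {inj₂ a} {inj₂ b} p q r → ψ.f-adj p q r
              ; {inj₁ a} {inj₂ b} _ _ _ → tt ; {inj₂ a} {inj₁ b} _ _ _ → tt }
  ; g-adj = λ { {inj₁ a} {inj₁ b} p q r → φ.g-adj p q r ; {inj₂ a} {inj₂ b} p q r → ψ.g-adj p q r
              ; {inj₁ a} {inj₂ b} _ _ _ → tt ; {inj₂ a} {inj₁ b} _ _ _ → tt }
  ; gf = λ { {inj₁ a} p → cong inj₁ (φ.gf p) ; {inj₂ b} p → cong inj₂ (ψ.gf p) }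
  ; fg = λ { {inj₁ a} p → cong inj₁ (φ.fg p) ; {inj₂ b} p → cong inj₂ (ψ.fg p) } }
  where
  module φ = _≃_ φ
  module ψ = _≃_ ψ

⊕-assoc : ∀ G H K → (G ⊕ H) ⊕ K ≃ G ⊕ (H ⊕ K)
⊕-assoc G H K = record
  { f = Sum.assocʳ ; g = Sum.assocˡ
  ; f-vtx = λ { {inj₁ (inj₁ a)} p → p ; {inj₁ (inj₂ b)} p → p ; {inj₂ c} p → p }
  ; g-vtx = λ { {inj₁ a} p → p ; {inj₂ (inj₁ b)} p → p ; {inj₂ (inj₂ c)} p → p }
  ; f-adj = λ { {inj₁ (inj₁ a)} {inj₁ (inj₁ b)} _ _ r → r ; {inj₁ (inj₁ a)} {inj₁ (inj₂ b)} _ _ r → tt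
              ; {inj₁ (inj₁ a)} {inj₂ b} _ _ r → tt ; {inj₁ (inj₂ a)} {inj₁ (inj₁ b)} _ _ r → tt
              ; {inj₁ (inj₂ a)} {inj₁ (inj₂ b)} _ _ r → r ; {inj₁ (inj₂ a)} {inj₂ b} _ _ r → tt
              ; {inj₂ a} {inj₁ (inj₁ b)} _ _ r → tt ; {inj₂ a} {inj₁ (inj₂ b)} _ _ r → tt
              ; {inj₂ a} {inj₂ b} _ _ r → r }
  ; g-adj = λ { {inj₁ a} {inj₁ b} _ _ r → r ; {inj₁ a} {inj₂ (inj₁ b)} _ _ r → tt
              ; {inj₁ a} {inj₂ (inj₂ b)} _ _ r → tt ; {inj₂ (inj₁ a)} {inj₁ b} _ _ r → tt
              ; {inj₂ (inj₁ a)} {inj₂ (inj₁ b)} _ _ r → r ; {inj₂ (inj₁ a)} {inj₂ (inj₂ b)} _ _ r → tt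
              ; {inj₂ (inj₂ a)} {inj₁ b} _ _ r → tt ; {inj₂ (inj₂ a)} {inj₂ (inj₁ b)} _ _ r → tt
              ; {inj₂ (inj₂ a)} {inj₂ (inj₂ b)} _ _ r → r }
  ; gf = λ { {inj₁ (inj₁ a)} p → refl ; {inj₁ (inj₂ b)} p → refl ; {inj₂ c} p → refl }
  ; fg = λ { {inj₁ a} p → refl ; {inj₂ (inj₁ b)} p → refl ; {inj₂ (inj₂ c)} p → refl } }

⊕-swap : ∀ G H K → G ⊕ (H ⊕ K) ≃ H ⊕ (G ⊕ K)
⊕-swap G H K = record
  { f = swap ; g = swap
  ; f-vtx = λ { {inj₁ a} p → p ; {inj₂ (inj₁ b)} p → p ; {inj₂ (inj₂ c)} p → p }
  ; g-vtx = λ { {inj₁ a} p → p ; {inj₂ (inj₁ b)} p → p ; {inj₂ (inj₂ c)} p → p }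
  ; f-adj = λ {x} {y} → swap-adj G H K {x} {y} ; g-adj = λ {x} {y} → swap-adj H G K {x} {y}
  ; gf = λ { {inj₁ a} p → refl ; {inj₂ (inj₁ b)} p → refl ; {inj₂ (inj₂ c)} p → refl }
  ; fg = λ { {inj₁ a} p → refl ; {inj₂ (inj₁ b)} p → refl ; {inj₂ (inj₂ c)} p → refl } }
  where
  swap : ∀ {A B C : Set} → A ⊎ (B ⊎ C) → B ⊎ (A ⊎ C)
  swap (inj₁ a)        = inj₂ (inj₁ a)
  swap (inj₂ (inj₁ b)) = inj₁ b
  swap (inj₂ (inj₂ c)) = inj₂ (inj₂ c)
  swap-adj : ∀ G H K {x y} {A B : Set} → A → B → Adj (G ⊕ (H ⊕ K)) x y → Adj (H ⊕ (G ⊕ K)) (swap x) (swap y)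
  swap-adj _ _ _ {inj₁ a}        {inj₁ b}        _ _ r = r
  swap-adj _ _ _ {inj₁ a}        {inj₂ (inj₁ b)} _ _ r = tt
  swap-adj _ _ _ {inj₁ a}        {inj₂ (inj₂ b)} _ _ r = tt
  swap-adj _ _ _ {inj₂ (inj₁ a)} {inj₁ b}        _ _ r = tt
  swap-adj _ _ _ {inj₂ (inj₁ a)} {inj₂ (inj₁ b)} _ _ r = r
  swap-adj _ _ _ {inj₂ (inj₁ a)} {inj₂ (inj₂ b)} _ _ r = tt
  swap-adj _ _ _ {inj₂ (inj₂ a)} {inj₁ b}        _ _ r = tt
  swap-adj _ _ _ {inj₂ (inj₂ a)} {inj₂ (inj₁ b)} _ _ r = tt
  swap-adj _ _ _ {inj₂ (inj₂ a)} {inj₂ (inj₂ b)} _ _ r = r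

⊕-identityʳ : ∀ G → G ⊕ ∅ᴳ ≃ G
⊕-identityʳ G = record
  { f = λ { (inj₁ a) → a ; (inj₂ ()) } ; g = inj₁
  ; f-vtx = λ { {inj₁ a} p → p ; {inj₂ ()} }
  ; g-vtx = λ p → p
  ; f-adj = λ { {inj₁ a} {inj₁ b} _ _ r → r ; {inj₂ ()} ; {_} {inj₂ ()} }
  ; g-adj = λ _ _ r → r
  ; gf = λ { {inj₁ a} p → refl ; {inj₂ ()} }
  ; fg = λ _ → refl }

⨁-↭ : ∀ {Gs Hs : List Graph} → Gs ↭ Hs → ⨁ Gs ≃ ⨁ Hs
⨁-↭ ↭.refl         = ≃-refl
⨁-↭ (↭.prep G p)   = ⊕-cong ≃-refl (⨁-↭ p)
⨁-↭ (↭.swap G H p) = ≃-trans (⊕-swap G H _) (⊕-cong ≃-refl (⊕-cong ≃-refl (⨁-↭ p)))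
⨁-↭ (↭.trans p q)  = ≃-trans (⨁-↭ p) (⨁-↭ q)

-- The complexes K_σ

≼-refl : ∀ {x} → x ≼ x
≼-refl = Pointwise.refl ≤-refl

≼-trans : ∀ {x y z} → x ≼ y → y ≼ z → x ≼ z
≼-trans = Pointwise.transitive ≤-trans

≼-antisym : ∀ {x y} → x ≼ y → y ≼ x → x ≡ y
≼-antisym p q = Pointwise.Pointwise-≡⇒≡ (Pointwise.antisymmetric ≤-antisym p q)

_≼?_ : ∀ x y → Dec (x ≼ y)
_≼?_ = Pointwise.decidable _≤?_

_⊝_ : List ℕ → List ℕ → List ℕ
_⊝_ = zipWith _∸_

_⊞_ : List ℕ → List ℕ → List ℕ
_⊞_ = zipWith _+_

infixl 30 _⊝_ _⊞_

zeros : ℕ → List ℕ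
zeros n = replicate n 0

zeros≼ : ∀ x → zeros (length x) ≼ x
zeros≼ []      = []
zeros≼ (a ∷ x) = z≤n ∷ zeros≼ x

≼zeros⇒≡ : ∀ {x n} → x ≼ zeros n → x ≡ zeros n
≼zeros⇒≡ {[]}    {zero}  []         = refl
≼zeros⇒≡ {a ∷ x} {suc n} (z≤n ∷ ps) = cong (0 ∷_) (≼zeros⇒≡ ps)

⊝-⊞ : ∀ {c y} → c ≼ y → (y ⊝ c) ⊞ c ≡ y
⊝-⊞ []       = refl
⊝-⊞ (p ∷ ps) = cong₂ _∷_ (m∸n+n≡m p) (⊝-⊞ ps)

⊞-⊝ : ∀ {w c} → length w ≡ length c → (w ⊞ c) ⊝ c ≡ w
⊞-⊝ {[]}    {[]}    _ = refl
⊞-⊝ {a ∷ w} {b ∷ c} e = cong₂ _∷_ (m+n∸n≡m a b) (⊞-⊝ (suc-injective e))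

≼-⊞ : ∀ {w c} → length w ≡ length c → c ≼ w ⊞ c
≼-⊞ {[]}    {[]}    _ = []
≼-⊞ {a ∷ w} {b ∷ c} e = m≤n+m b a ∷ ≼-⊞ (suc-injective e)

⊝-monoˡ : ∀ {y y′} c → y ≼ y′ → y ⊝ c ≼ y′ ⊝ c
⊝-monoˡ []      []       = []
⊝-monoˡ []      (_ ∷ _)  = []
⊝-monoˡ (b ∷ c) []       = []
⊝-monoˡ (b ∷ c) (p ∷ ps) = ∸-monoˡ-≤ b p ∷ ⊝-monoˡ c ps

⊞-monoˡ : ∀ {w w′} c → w ≼ w′ → w ⊞ c ≼ w′ ⊞ c
⊞-monoˡ []      []       = []
⊞-monoˡ []      (_ ∷ _)  = []
⊞-monoˡ (b ∷ c) []       = []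
⊞-monoˡ (b ∷ c) (p ∷ ps) = +-monoˡ-≤ b p ∷ ⊞-monoˡ c ps

length-⊝ : ∀ s c → length c ≡ length s → length (s ⊝ c) ≡ length s
length-⊝ []      []      _ = refl
length-⊝ (a ∷ s) (b ∷ c) e = cong suc (length-⊝ s c (suc-injective e))

⊝-self : ∀ c → c ⊝ c ≡ zeros (length c)
⊝-self []      = refl
⊝-self (a ∷ c) = cong₂ _∷_ (n∸n≡0 a) (⊝-self c)

zeros-⊞ : ∀ c → zeros (length c) ⊞ c ≡ c
zeros-⊞ []      = refl
zeros-⊞ (a ∷ c) = cong (a ∷_) (zeros-⊞ c)

⊝≡zeros⇒≡ : ∀ {c y} → c ≼ y → y ⊝ c ≡ zeros (length c) → y ≡ c
⊝≡zeros⇒≡ {c} {y} c≼y e = begin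
  y                    ≡⟨ sym (⊝-⊞ c≼y) ⟩
  y ⊝ c ⊞ c            ≡⟨ cong (_⊞ c) e ⟩
  zeros (length c) ⊞ c ≡⟨ zeros-⊞ c ⟩
  c                    ∎
  where open ≡-Reasoning

-- Flag (Kᴳ σ) is Kσ σ by definition.
Kᴳ : List ℕ → Graph
Kᴳ σ = record { Carrier = List ℕ ; Vtx = ProperElem σ ; Adj = λ x y → x ≼ y ⊎ y ≼ x }

-- The link of c in K_s splits into the part below c and the part above c, which is K_{s - c} after
-- translation by c.
module VertexLinkᴷ (s c : List ℕ) (pc : ProperElem s c) where

  open ≡-Reasoning

  c≼s : c ≼ s
  c≼s = proj₁ pc

  c≢0 : c ≢ zeros (length s)
  c≢0 = proj₁ (proj₂ pc)

  c≢s : c ≢ s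
  c≢s = proj₂ (proj₂ pc)

  c-length : length c ≡ length s
  c-length = Pointwise-length c≼s

  s⊝c-length : length (s ⊝ c) ≡ length c
  s⊝c-length = trans (length-⊝ s c c-length) (sym c-length)

  length-below-s⊝c : ∀ {w} → w ≼ s ⊝ c → length w ≡ length c
  length-below-s⊝c p = trans (Pointwise-length p) s⊝c-length

  split : List ℕ → List ℕ ⊎ List ℕ
  split y with y ≼? c
  ... | yes _ = inj₁ y
  ... | no _  = inj₂ (y ⊝ c)

  merge : List ℕ ⊎ List ℕ → List ℕ
  merge (inj₁ z) = z
  merge (inj₂ w) = w ⊞ c

  split-≼ : ∀ {y} → y ≼ c → split y ≡ inj₁ y
  split-≼ {y} p with y ≼? c
  ... | yes _ = refl
  ... | no ¬p = ⊥-elim (¬p p)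

  InLink : List ℕ → Set
  InLink = Vtx (linkᴳ (Kᴳ s) [ c ])

  InSum : List ℕ ⊎ List ℕ → Set
  InSum = Vtx (Kᴳ c ⊕ Kᴳ (s ⊝ c))

  above : ∀ {y} → InLink y → ¬ y ≼ c → c ≼ y
  above (_ , _ , (inj₁ y≼c , _) ∷ []) y⋠c = ⊥-elim (y⋠c y≼c)
  above (_ , _ , (inj₂ c≼y , _) ∷ []) _   = c≼y

  merge-above≢c : ∀ {w} → ProperElem (s ⊝ c) w → w ⊞ c ≢ c
  merge-above≢c {w} (p , w≢0 , _) e = w≢0 (begin
    w                    ≡⟨ sym (⊞-⊝ (length-below-s⊝c p)) ⟩
    w ⊞ c ⊝ c            ≡⟨ cong (_⊝ c) e ⟩
    c ⊝ c                ≡⟨ ⊝-self c ⟩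
    zeros (length c)     ≡⟨ cong zeros (sym s⊝c-length) ⟩
    zeros (length (s ⊝ c)) ∎)

  split-vtx : ∀ {y} → InLink y → InSum (split y)
  split-vtx {y} ((y≼s , y≢0 , y≢s) , y∉c , _) with y ≼? c
  ... | yes y≼c = y≼c , subst (λ m → y ≢ zeros m) (sym c-length) y≢0 , (λ e → y∉c (here e))
  split-vtx {y} iy@((y≼s , y≢0 , y≢s) , y∉c , _) | no y⋠c = ⊝-monoˡ c y≼s , y⊝c≢0 , y⊝c≢s⊝c
    where
    c≼y : c ≼ y
    c≼y = above iy y⋠c
    y⊝c≢0 : y ⊝ c ≢ zeros (length (s ⊝ c))
    y⊝c≢0 e = y∉c (here (⊝≡zeros⇒≡ c≼y (trans e (cong zeros s⊝c-length))))
    y⊝c≢s⊝c : y ⊝ c ≢ s ⊝ c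
    y⊝c≢s⊝c e = y≢s (trans (sym (⊝-⊞ c≼y)) (trans (cong (_⊞ c) e) (⊝-⊞ c≼s)))

  merge-vtx : ∀ {t} → InSum t → InLink (merge t)
  merge-vtx {inj₁ z} (z≼c , z≢0 , z≢c) =
    (≼-trans z≼c c≼s , subst (λ m → z ≢ zeros m) c-length z≢0 , (λ e → c≢s (≼-antisym c≼s (subst (_≼ c) e z≼c))))
    , ∉-[ z≢c ] , (inj₁ z≼c , inj₂ z≼c) ∷ []
  merge-vtx {inj₂ w} pw@(w≼ , w≢0 , w≢s⊝c) =
    (subst (w ⊞ c ≼_) (⊝-⊞ c≼s) (⊞-monoˡ c w≼) , w⊞c≢0 , w⊞c≢s) , ∉-[ merge-above≢c pw ] , (inj₂ c≼w⊞c , inj₁ c≼w⊞c) ∷ []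
    where
    c≼w⊞c : c ≼ w ⊞ c
    c≼w⊞c = ≼-⊞ (length-below-s⊝c w≼)
    w⊞c≢0 : w ⊞ c ≢ zeros (length s)
    w⊞c≢0 e = c≢0 (≼zeros⇒≡ (subst (c ≼_) e c≼w⊞c))
    w⊞c≢s : w ⊞ c ≢ s
    w⊞c≢s e = w≢s⊝c (trans (sym (⊞-⊝ (length-below-s⊝c w≼))) (cong (_⊝ c) e))

  split-adj : ∀ {x y} → InLink x → InLink y → Adj (Kᴳ s) x y → Adj (Kᴳ c ⊕ Kᴳ (s ⊝ c)) (split x) (split y)
  split-adj {x} {y} _ _ r with x ≼? c | y ≼? c
  ... | yes _ | yes _ = r
  ... | yes _ | no _  = tt
  ... | no _  | yes _ = tt
  ... | no _  | no _  = Sum.map (⊝-monoˡ c) (⊝-monoˡ c) r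

  merge-adj : ∀ {a b} → InSum a → InSum b → Adj (Kᴳ c ⊕ Kᴳ (s ⊝ c)) a b → Adj (Kᴳ s) (merge a) (merge b)
  merge-adj {inj₁ z} {inj₁ z′} _ _ r = r
  merge-adj {inj₁ z} {inj₂ w} (z≼c , _) (w≼ , _) _ = inj₁ (≼-trans z≼c (≼-⊞ (length-below-s⊝c w≼)))
  merge-adj {inj₂ w} {inj₁ z} (w≼ , _) (z≼c , _) _ = inj₂ (≼-trans z≼c (≼-⊞ (length-below-s⊝c w≼)))
  merge-adj {inj₂ w} {inj₂ w′} _ _ r = Sum.map (⊞-monoˡ c) (⊞-monoˡ c) r

  merge-split : ∀ {y} → InLink y → merge (split y) ≡ y
  merge-split {y} iy with y ≼? c
  ... | yes _   = refl
  ... | no y⋠c = ⊝-⊞ (above iy y⋠c)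

  split-merge : ∀ {t} → InSum t → split (merge t) ≡ t
  split-merge {inj₁ z} (z≼c , _) = split-≼ z≼c
  split-merge {inj₂ w} pw@(w≼ , _) with w ⊞ c ≼? c
  ... | yes w⊞c≼c = ⊥-elim (merge-above≢c pw (≼-antisym w⊞c≼c (≼-⊞ (length-below-s⊝c w≼))))
  ... | no _       = cong inj₂ (⊞-⊝ (length-below-s⊝c w≼))

linkᴳ-Kᴳ : ∀ s c → ProperElem s c → linkᴳ (Kᴳ s) [ c ] ≃ Kᴳ c ⊕ Kᴳ (s ⊝ c)
linkᴳ-Kᴳ s c pc = record
  { f = split ; g = merge ; f-vtx = split-vtx ; g-vtx = λ {t} → merge-vtx {t}
  ; f-adj = split-adj ; g-adj = λ {a} {b} → merge-adj {a} {b}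
  ; gf = merge-split ; fg = λ {t} → split-merge {t} }
  where open VertexLinkᴷ s c pc

record IntervalIso (s s′ : List ℕ) : Set where
  field
    h       : List ℕ → List ℕ
    h′      : List ℕ → List ℕ
    h-≼     : ∀ {x} → x ≼ s → h x ≼ s′
    h′-≼    : ∀ {y} → y ≼ s′ → h′ y ≼ s
    h-mono  : ∀ {x y} → x ≼ y → h x ≼ h y
    h′-mono : ∀ {x y} → x ≼ y → h′ x ≼ h′ y
    h′h     : ∀ {x} → x ≼ s → h′ (h x) ≡ x
    hh′     : ∀ {y} → y ≼ s′ → h (h′ y) ≡ y
    h-zeros  : h (zeros (length s)) ≡ zeros (length s′)
    h′-zeros : h′ (zeros (length s′)) ≡ zeros (length s)
    h-top   : h s ≡ s′
    h′-top  : h′ s′ ≡ s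

Kᴳ-cong : ∀ {s s′} → IntervalIso s s′ → Kᴳ s ≃ Kᴳ s′
Kᴳ-cong {s} {s′} φ = record
  { f = h ; g = h′
  ; f-vtx = λ (p , x≢0 , x≢s) → h-≼ p , (λ e → x≢0 (trans (sym (h′h p)) (trans (cong h′ e) h′-zeros)))
                                      , (λ e → x≢s (trans (sym (h′h p)) (trans (cong h′ e) h′-top)))
  ; g-vtx = λ (p , y≢0 , y≢s′) → h′-≼ p , (λ e → y≢0 (trans (sym (hh′ p)) (trans (cong h e) h-zeros)))
                                        , (λ e → y≢s′ (trans (sym (hh′ p)) (trans (cong h e) h-top)))
  ; f-adj = λ _ _ → Sum.map h-mono h-mono
  ; g-adj = λ _ _ → Sum.map h′-mono h′-mono
  ; gf = λ p → h′h (proj₁ p) ; fg = λ p → hh′ (proj₁ p) }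
  where open IntervalIso φ

compress : List ℕ → List ℕ → List ℕ
compress []          x       = []
compress (_ ∷ s)     []      = []
compress (zero ∷ s)  (a ∷ x) = compress s x
compress (suc _ ∷ s) (a ∷ x) = a ∷ compress s x

expand : List ℕ → List ℕ → List ℕ
expand []          w       = []
expand (zero ∷ s)  w       = 0 ∷ expand s w
expand (suc _ ∷ s) []      = []
expand (suc _ ∷ s) (a ∷ w) = a ∷ expand s w

compress-mono : ∀ s {x y} → x ≼ y → compress s x ≼ compress s y
compress-mono []          _        = []
compress-mono (_ ∷ s)     []       = []
compress-mono (zero ∷ s)  (p ∷ ps) = compress-mono s ps
compress-mono (suc _ ∷ s) (p ∷ ps) = p ∷ compress-mono s ps

expand-mono : ∀ s {x y} → x ≼ y → expand s x ≼ expand s y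
expand-mono []          _        = []
expand-mono (zero ∷ s)  ps       = z≤n ∷ expand-mono s ps
expand-mono (suc _ ∷ s) []       = []
expand-mono (suc _ ∷ s) (p ∷ ps) = p ∷ expand-mono s ps

expand-compress : ∀ s {x} → x ≼ s → expand s (compress s x) ≡ x
expand-compress []          []           = refl
expand-compress (zero ∷ s)  (z≤n ∷ ps)   = cong (0 ∷_) (expand-compress s ps)
expand-compress (suc _ ∷ s) (p ∷ ps)     = cong (_ ∷_) (expand-compress s ps)

compress-expand : ∀ s {w} → w ≼ compress s s → compress s (expand s w) ≡ w
compress-expand []          []       = refl
compress-expand (zero ∷ s)  ps       = compress-expand s ps
compress-expand (suc _ ∷ s) (p ∷ ps) = cong (_ ∷_) (compress-expand s ps)

compress-zeros : ∀ s → compress s (zeros (length s)) ≡ zeros (length (compress s s))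
compress-zeros []          = refl
compress-zeros (zero ∷ s)  = compress-zeros s
compress-zeros (suc _ ∷ s) = cong (0 ∷_) (compress-zeros s)

expand-zeros : ∀ s → expand s (zeros (length (compress s s))) ≡ zeros (length s)
expand-zeros []          = refl
expand-zeros (zero ∷ s)  = cong (0 ∷_) (expand-zeros s)
expand-zeros (suc _ ∷ s) = cong (0 ∷_) (expand-zeros s)

compress-positive : ∀ s → All (1 ≤_) (compress s s)
compress-positive []          = []
compress-positive (zero ∷ s)  = compress-positive s
compress-positive (suc _ ∷ s) = s≤s z≤n ∷ compress-positive s

sum-compress : ∀ s → sum (compress s s) ≡ sum s
sum-compress []          = refl
sum-compress (zero ∷ s)  = sum-compress s
sum-compress (suc a ∷ s) = cong (suc a +_) (sum-compress s)

compress-intervalIso : ∀ s → IntervalIso s (compress s s)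
compress-intervalIso s = record
  { h = compress s ; h′ = expand s
  ; h-≼ = compress-mono s
  ; h′-≼ = λ p → subst (expand s _ ≼_) (expand-compress s ≼-refl) (expand-mono s p)
  ; h-mono = compress-mono s ; h′-mono = expand-mono s
  ; h′h = expand-compress s ; hh′ = compress-expand s
  ; h-zeros = compress-zeros s ; h′-zeros = expand-zeros s
  ; h-top = refl ; h′-top = expand-compress s ≼-refl }

permute : ∀ {s s′ : List ℕ} → s ↭ s′ → List ℕ → List ℕ
permute ↭.refl         x           = x
permute (↭.prep _ p)   []          = []
permute (↭.prep _ p)   (a ∷ x)     = a ∷ permute p x
permute (↭.swap _ _ p) (a ∷ b ∷ x) = b ∷ a ∷ permute p x
permute (↭.swap _ _ p) x           = x
permute (↭.trans p q)  x           = permute q (permute p x)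

permute-pointwise : ∀ {R : ℕ → ℕ → Set} {s s′} (p : s ↭ s′) {x y} → Pointwise R x y → Pointwise R (permute p x) (permute p y)
permute-pointwise ↭.refl         rs                = rs
permute-pointwise (↭.prep _ p)   []                = []
permute-pointwise (↭.prep _ p)   (r ∷ rs)          = r ∷ permute-pointwise p rs
permute-pointwise (↭.swap _ _ p) []                = []
permute-pointwise (↭.swap _ _ p) (r ∷ [])          = r ∷ []
permute-pointwise (↭.swap _ _ p) (r ∷ r′ ∷ rs)     = r′ ∷ r ∷ permute-pointwise p rs
permute-pointwise (↭.trans p q)  rs                = permute-pointwise q (permute-pointwise p rs)

permute-self : ∀ {s s′} (p : s ↭ s′) → permute p s ≡ s′
permute-self ↭.refl         = refl
permute-self (↭.prep _ p)   = cong (_ ∷_) (permute-self p)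
permute-self (↭.swap _ _ p) = cong (λ z → _ ∷ _ ∷ z) (permute-self p)
permute-self (↭.trans p q)  = trans (cong (permute q) (permute-self p)) (permute-self q)

permute-≼ : ∀ {s s′} (p : s ↭ s′) {x} → x ≼ s → permute p x ≼ s′
permute-≼ p {x} r = subst (permute p x ≼_) (permute-self p) (permute-pointwise p r)

permute-inverse : ∀ {s s′} (p : s ↭ s′) {x} → x ≼ s → permute (↭-sym p) (permute p x) ≡ x
permute-inverse ↭.refl         r             = refl
permute-inverse (↭.prep _ p)   (r ∷ rs)      = cong (_ ∷_) (permute-inverse p rs)
permute-inverse (↭.swap _ _ p) (r ∷ r′ ∷ rs) = cong (λ z → _ ∷ _ ∷ z) (permute-inverse p rs)
permute-inverse (↭.trans p q)  r             =
  trans (cong (permute (↭-sym p)) (permute-inverse q (permute-≼ p r))) (permute-inverse p r)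

permute-inverseʳ : ∀ {s s′} (p : s ↭ s′) {y} → y ≼ s′ → permute p (permute (↭-sym p) y) ≡ y
permute-inverseʳ p {y} r =
  subst (λ p′ → permute p′ (permute (↭-sym p) y) ≡ y) (↭-sym-involutive p) (permute-inverse (↭-sym p) r)

permute-zeros : ∀ {s s′} (p : s ↭ s′) → permute p (zeros (length s)) ≡ zeros (length s′)
permute-zeros {s} {s′} p = zeros-of (subst (Pointwise _ _) (permute-self p) (permute-pointwise p (is-zeros s)))
  where
  is-zeros : ∀ s → Pointwise (λ a _ → a ≡ 0) (zeros (length s)) s
  is-zeros []      = []
  is-zeros (_ ∷ s) = refl ∷ is-zeros s
  zeros-of : ∀ {x s} → Pointwise (λ a _ → a ≡ 0) x s → x ≡ zeros (length s)
  zeros-of []         = refl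
  zeros-of (refl ∷ r) = cong (0 ∷_) (zeros-of r)

↭-intervalIso : ∀ {s s′} → s ↭ s′ → IntervalIso s s′
↭-intervalIso p = record
  { h = permute p ; h′ = permute (↭-sym p)
  ; h-≼ = permute-≼ p ; h′-≼ = permute-≼ (↭-sym p)
  ; h-mono = permute-pointwise p ; h′-mono = permute-pointwise (↭-sym p)
  ; h′h = permute-inverse p ; hh′ = permute-inverseʳ p
  ; h-zeros = permute-zeros p ; h′-zeros = permute-zeros (↭-sym p)
  ; h-top = permute-self p ; h′-top = permute-self (↭-sym p) }

module SortBy {A : Set} (key : A → ℕ) where

  insert : A → List A → List A
  insert a []       = a ∷ []
  insert a (b ∷ bs) with key b ≤? key a
  ... | yes _ = a ∷ b ∷ bs
  ... | no _  = b ∷ insert a bs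

  sort : List A → List A
  sort []       = []
  sort (a ∷ as) = insert a (sort as)

  Descending : List A → Set
  Descending = Linked (λ a b → key a ≥ key b)

  insert-descending-∷ : ∀ a b bs → key a ≤ key b → Descending (b ∷ bs) → Descending (b ∷ insert a bs)
  insert-descending-∷ a b []       a≤b _        = a≤b ∷ [-]
  insert-descending-∷ a b (c ∷ cs) a≤b (r ∷ rs) with key c ≤? key a
  ... | yes c≤a = a≤b ∷ c≤a ∷ rs
  ... | no c≰a  = r ∷ insert-descending-∷ a c cs (<⇒≤ (≰⇒> c≰a)) rs

  insert-descending : ∀ a bs → Descending bs → Descending (insert a bs)
  insert-descending a []       _  = [-]
  insert-descending a (b ∷ bs) rs with key b ≤? key a
  ... | yes b≤a = b≤a ∷ rs
  ... | no b≰a  = insert-descending-∷ a b bs (<⇒≤ (≰⇒> b≰a)) rs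

  sort-descending : ∀ as → Descending (sort as)
  sort-descending []       = []
  sort-descending (a ∷ as) = insert-descending a (sort as) (sort-descending as)

  insert-↭ : ∀ a bs → a ∷ bs ↭ insert a bs
  insert-↭ a []       = ↭.refl
  insert-↭ a (b ∷ bs) with key b ≤? key a
  ... | yes _ = ↭.refl
  ... | no _  = ↭.trans (↭.swap a b ↭.refl) (↭.prep b (insert-↭ a bs))

  sort-↭ : ∀ as → as ↭ sort as
  sort-↭ []       = ↭.refl
  sort-↭ (a ∷ as) = ↭.trans (↭.prep a (sort-↭ as)) (insert-↭ a (sort as))

normalize : List ℕ → List ℕ
normalize s = SortBy.sort (λ x → x) (compress s s)

Kᴳ-normalize : ∀ s → Kᴳ s ≃ Kᴳ (normalize s)
Kᴳ-normalize s = ≃-trans (Kᴳ-cong (compress-intervalIso s)) (Kᴳ-cong (↭-intervalIso (SortBy.sort-↭ (λ x → x) (compress s s))))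

normalize-isPartition : ∀ s → IsPartition (sum s) (normalize s)
normalize-isPartition s =
  All-resp-↭ p (compress-positive s) , SortBy.sort-descending (λ x → x) (compress s s) , trans (sym (sum-↭ p)) (sum-compress s)
  where
  p : compress s s ↭ normalize s
  p = SortBy.sort-↭ (λ x → x) (compress s s)

Kᴳs : List (List ℕ) → Graph
Kᴳs Ls = ⨁ (map Kᴳ Ls)

record KJoin (G : Graph) (t k : ℕ) : Set where
  field
    factors  : List (List ℕ)
    iso      : G ≃ Kᴳs factors
    length≡  : length factors ≡ t
    sum≡     : sum (map sum factors) ≡ k
    positive : All (λ s → 1 ≤ sum s) factors

KJoin-≃ : ∀ {G H t k} → G ≃ H → KJoin H t k → KJoin G t k
KJoin-≃ φ J = record { KJoin J ; iso = ≃-trans φ (KJoin.iso J) }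

sum-⊝ : ∀ {c s} → c ≼ s → sum c + sum (s ⊝ c) ≡ sum s
sum-⊝ []                       = refl
sum-⊝ {b ∷ c} {a ∷ s} (p ∷ ps) = trans (interchange b (sum c) (a ∸ b) (sum (s ⊝ c)))
  (cong₂ _+_ (trans (+-comm b (a ∸ b)) (m∸n+n≡m p)) (sum-⊝ ps))

sum-positive : ∀ x → x ≢ zeros (length x) → 1 ≤ sum x
sum-positive []          x≢0 = ⊥-elim (x≢0 refl)
sum-positive (zero ∷ x)  x≢0 = sum-positive x (λ e → x≢0 (cong (0 ∷_) e))
sum-positive (suc a ∷ x) _   = s≤s z≤n

⊝-nonzero : ∀ {c s} → c ≼ s → c ≢ s → s ⊝ c ≢ zeros (length (s ⊝ c))
⊝-nonzero {c} {s} c≼s c≢s e = c≢s (sym (⊝≡zeros⇒≡ c≼s (trans e (cong zeros (trans (length-⊝ s c c-length) (sym c-length))))))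
  where
  c-length : length c ≡ length s
  c-length = Pointwise-length c≼s

linkᴳ-Kᴳs : ∀ Ls w → All (λ s → 1 ≤ sum s) Ls → Vtx (Kᴳs Ls) w →
            KJoin (linkᴳ (Kᴳs Ls) [ w ]) (suc (length Ls)) (sum (map sum Ls))
linkᴳ-Kᴳs (s ∷ Ls) (inj₁ c) (_ ∷ pos) pc@(c≼s , c≢0 , c≢s) = record
  { factors = c ∷ (s ⊝ c) ∷ Ls
  ; iso = ≃-trans (linkᴳ-⊕ˡ (Kᴳ s) (Kᴳs Ls) c) (≃-trans (⊕-cong (linkᴳ-Kᴳ s c pc) ≃-refl) (⊕-assoc _ _ _))
  ; length≡ = refl
  ; sum≡ = trans (sym (+-assoc (sum c) (sum (s ⊝ c)) _)) (cong (_+ sum (map sum Ls)) (sum-⊝ c≼s))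
  ; positive = sum-positive c (λ e → c≢0 (trans e (cong zeros (Pointwise-length c≼s))))
             ∷ sum-positive (s ⊝ c) (⊝-nonzero c≼s c≢s) ∷ pos }
linkᴳ-Kᴳs (s ∷ Ls) (inj₂ w) (p ∷ pos) pw = record
  { factors = s ∷ factors
  ; iso = ≃-trans (linkᴳ-⊕ʳ (Kᴳ s) (Kᴳs Ls) w) (⊕-cong ≃-refl iso)
  ; length≡ = cong suc length≡
  ; sum≡ = cong (sum s +_) sum≡
  ; positive = p ∷ positive }
  where open KJoin (linkᴳ-Kᴳs Ls w pos pw)

KJoin-link : ∀ {G t k x} → KJoin G t k → Vtx G x → KJoin (linkᴳ G [ x ]) (suc t) k
KJoin-link {G} {t} {k} {x} J vx =
  KJoin-≃ (linkᴳ-cong iso [ x ] (vx ∷ []))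
    (subst₂ (KJoin _) (cong suc length≡) sum≡ (linkᴳ-Kᴳs factors (_≃_.f iso x) positive (_≃_.f-vtx iso vx)))
  where open KJoin J

sum-normalize : ∀ s → sum (normalize s) ≡ sum s
sum-normalize s = proj₂ (proj₂ (normalize-isPartition s))

Kᴳs-normalize : ∀ Ls → Kᴳs Ls ≃ Kᴳs (map normalize Ls)
Kᴳs-normalize []       = ≃-refl
Kᴳs-normalize (s ∷ Ls) = ⊕-cong (Kᴳ-normalize s) (Kᴳs-normalize Ls)

KJoin-normalForm : ∀ {G t k} → KJoin G t k →
                   Σ (List (List ℕ)) λ L → (G ≃ Kᴳs L) × length L ≡ t × IsPartition k (map sum L)
                                         × All (λ s → IsPartition (sum s) s) L
KJoin-normalForm {G} {t} {k} J =
  L , ≃-trans iso (≃-trans (Kᴳs-normalize factors) (⨁-↭ (↭ₚ.map⁺ Kᴳ sorted)))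
    , trans (sym (↭-length sorted)) (trans (length-map normalize factors) length≡)
    , (Allₚ.map⁺ (All-resp-↭ sorted (normalized-positive positive)) , Linkedₚ.map⁺ (SortBy.sort-descending sum normalized)
      , trans (sym (sum-↭ (↭ₚ.map⁺ sum sorted))) (trans (normalized-sum factors) sum≡))
    , All-resp-↭ sorted (normalized-isPartition factors)
  where
  open KJoin J
  normalized : List (List ℕ)
  normalized = map normalize factors
  L : List (List ℕ)
  L = SortBy.sort sum normalized
  sorted : normalized ↭ L
  sorted = SortBy.sort-↭ sum normalized
  normalized-positive : ∀ {Ls} → All (λ s → 1 ≤ sum s) Ls → All (λ s → 1 ≤ sum s) (map normalize Ls)
  normalized-positive []       = []
  normalized-positive {s ∷ _} (p ∷ ps) = subst (1 ≤_) (sym (sum-normalize s)) p ∷ normalized-positive ps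
  normalized-sum : ∀ Ls → sum (map sum (map normalize Ls)) ≡ sum (map sum Ls)
  normalized-sum []       = refl
  normalized-sum (s ∷ Ls) = cong₂ _+_ (sum-normalize s) (normalized-sum Ls)
  normalized-isPartition : ∀ Ls → All (λ s → IsPartition (sum s) s) (map normalize Ls)
  normalized-isPartition []       = []
  normalized-isPartition (s ∷ Ls) =
    subst (λ m → IsPartition m (normalize s)) (sym (sum-normalize s)) (normalize-isPartition s) ∷ normalized-isPartition Ls

-- T_{k,q} as a flag complex

Ascending : List ℕ → Set
Ascending = Linked _≤_

sucs : List ℕ → List ℕ
sucs = map suc

Step : List ℕ → List ℕ → Set
Step A B = A ≼ B × B ≼ sucs A

Comparable : List ℕ → List ℕ → Set
Comparable A B = Step A B ⊎ Step B A

Tᴳ : ℕ → ℕ → Graph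
Tᴳ n q = record
  { Carrier = Vec ℕ n
  ; Vtx = λ y → Ascending (toList y) × All (_≤ q) (toList y)
  ; Adj = λ a b → Comparable (toList a) (toList b) }

ascending-head : ∀ {a l} → Ascending (a ∷ l) → All (a ≤_) l
ascending-head [-]      = []
ascending-head (r ∷ rs) = Linked⇒All ≤-trans r rs

ascending-tail : ∀ {a l} → Ascending (a ∷ l) → Ascending l
ascending-tail [-]      = []
ascending-tail (_ ∷ rs) = rs

ascending-∷ : ∀ {a l} → All (a ≤_) l → Ascending l → Ascending (a ∷ l)
ascending-∷ []      _  = [-]
ascending-∷ (p ∷ _) rs = p ∷ rs

InW⇒Vtx : ∀ {n q} (x : Vec ℕ n) → InW q x → Vtx (Tᴳ n q) x
InW⇒Vtx []          _           = [] , []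
InW⇒Vtx (a ∷ [])    (_ , bd)    = [-] , bd Fin.zero ∷ []
InW⇒Vtx (a ∷ b ∷ x) (mono , bd) with InW⇒Vtx (b ∷ x) ((λ i j i≤j → mono (Fin.suc i) (Fin.suc j) (s≤s i≤j)) , λ i → bd (Fin.suc i))
... | asc , bds = mono Fin.zero (Fin.suc Fin.zero) z≤n ∷ asc , bd Fin.zero ∷ bds

Vtx⇒InW : ∀ {n q} (x : Vec ℕ n) → Vtx (Tᴳ n q) x → InW q x
Vtx⇒InW []      _                         = (λ ()) , λ ()
Vtx⇒InW {q = q} (a ∷ x) (asc , a≤q ∷ bds) = mono , bd
  where
  rec : InW q x
  rec = Vtx⇒InW x (ascending-tail asc , bds)
  a≤ : ∀ {m} {y : Vec ℕ m} → All (a ≤_) (toList y) → ∀ j → a ≤ lookup y j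
  a≤ {y = _ ∷ _} (p ∷ _)  Fin.zero    = p
  a≤ {y = _ ∷ _} (_ ∷ ps) (Fin.suc j) = a≤ ps j
  mono : ∀ i j → Fin.toℕ i ≤ Fin.toℕ j → lookup (a ∷ x) i ≤ lookup (a ∷ x) j
  mono Fin.zero    Fin.zero    _         = ≤-refl
  mono Fin.zero    (Fin.suc j) _         = a≤ (ascending-head asc) j
  mono (Fin.suc i) (Fin.suc j) (s≤s i≤j) = proj₁ rec i j i≤j
  bd : ∀ i → lookup (a ∷ x) i ≤ q
  bd Fin.zero    = a≤q
  bd (Fin.suc i) = proj₂ rec i

toList-pointwise⁺ : ∀ {n} {R : ℕ → ℕ → Set} (a b : Vec ℕ n) → (∀ i → R (lookup a i) (lookup b i)) →
                    Pointwise R (toList a) (toList b)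
toList-pointwise⁺ []      []      _ = []
toList-pointwise⁺ (x ∷ a) (y ∷ b) r = r Fin.zero ∷ toList-pointwise⁺ a b (λ i → r (Fin.suc i))

toList-pointwise⁻ : ∀ {n} {R : ℕ → ℕ → Set} (a b : Vec ℕ n) → Pointwise R (toList a) (toList b) →
                    ∀ i → R (lookup a i) (lookup b i)
toList-pointwise⁻ (x ∷ a) (y ∷ b) (r ∷ rs) Fin.zero    = r
toList-pointwise⁻ (x ∷ a) (y ∷ b) (r ∷ rs) (Fin.suc i) = toList-pointwise⁻ a b rs i

≼-sucs⁺ : ∀ {A B} → Pointwise (λ a b → b ≤ suc a) A B → B ≼ sucs A
≼-sucs⁺ []       = []
≼-sucs⁺ (r ∷ rs) = r ∷ ≼-sucs⁺ rs

≼-sucs⁻ : ∀ {A B} → B ≼ sucs A → Pointwise (λ a b → b ≤ suc a) A B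
≼-sucs⁻ {[]}    {[]}    []       = []
≼-sucs⁻ {_ ∷ _} {_ ∷ _} (r ∷ rs) = r ∷ ≼-sucs⁻ rs

𝟙 : Bool → ℕ
𝟙 b = if b then 1 else 0

𝟙-mono : ∀ {b b′} → (Tᵇ b → Tᵇ b′) → 𝟙 b ≤ 𝟙 b′
𝟙-mono {true}  {true}  _    = ≤-refl
𝟙-mono {true}  {false} b⇒b′ = ⊥-elim (b⇒b′ tt)
𝟙-mono {false}         _    = z≤n

module _ {A : Set} where

  count : (A → Bool) → List A → ℕ
  count p []      = 0
  count p (a ∷ l) = 𝟙 (p a) + count p l

  count-mono : ∀ (p p′ : A → Bool) l → (∀ {a} → a ∈ l → Tᵇ (p a) → Tᵇ (p′ a)) → count p l ≤ count p′ l
  count-mono p p′ []      _    = z≤n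
  count-mono p p′ (a ∷ l) p⇒p′ = +-mono-≤ (𝟙-mono (p⇒p′ (here refl))) (count-mono p p′ l (λ m → p⇒p′ (there m)))

  count-< : ∀ (p p′ : A → Bool) l → (∀ {a} → a ∈ l → Tᵇ (p a) → Tᵇ (p′ a)) →
            ∀ {b} → b ∈ l → Tᵇ (p′ b) → ¬ Tᵇ (p b) → count p l < count p′ l
  count-< p p′ (a ∷ l) p⇒p′ (here refl) p′a ¬pa with p a | p′ a
  ... | true  | _     = ⊥-elim (¬pa tt)
  ... | false | false = ⊥-elim p′a
  ... | false | true  = s≤s (count-mono p p′ l (λ m → p⇒p′ (there m)))
  count-< p p′ (a ∷ l) p⇒p′ (there b∈l) p′b ¬pb = begin-strict
    𝟙 (p a) + count p l   <⟨ +-monoʳ-< (𝟙 (p a)) (count-< p p′ l (λ m → p⇒p′ (there m)) b∈l p′b ¬pb) ⟩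
    𝟙 (p a) + count p′ l  ≤⟨ +-monoˡ-≤ (count p′ l) (𝟙-mono (p⇒p′ (here refl))) ⟩
    𝟙 (p′ a) + count p′ l ∎
    where open ≤-Reasoning

  there-witness : ∀ {P : A → Set} {a l} → ∃ (λ b → b ∈ l × P b) → ∃ λ b → b ∈ a ∷ l × P b
  there-witness (b , b∈l , pb) = b , there b∈l , pb

  count-witness : ∀ (p p′ : A → Bool) l → count p l < count p′ l → ∃ λ b → b ∈ l × Tᵇ (p′ b) × ¬ Tᵇ (p b)
  count-witness p p′ (a ∷ l) lt with p a in pa | p′ a in p′a
  ... | false | true  = a , here refl , subst Tᵇ (sym p′a) tt , subst (λ b → ¬ Tᵇ b) (sym pa) (λ ())
  ... | true  | true  = there-witness (count-witness p p′ l (≤-pred lt))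
  ... | false | false = there-witness (count-witness p p′ l lt)
  ... | true  | false = there-witness (count-witness p p′ l (≤-trans (n≤1+n _) lt))

  count-complement : ∀ (p : A → Bool) l → count p l + count (λ a → not (p a)) l ≡ length l
  count-complement p []      = refl
  count-complement p (a ∷ l) with p a
  ... | true  = cong suc (count-complement p l)
  ... | false = trans (+-suc (count p l) _) (cong suc (count-complement p l))

  count-≤-length : ∀ (p : A → Bool) l → count p l ≤ length l
  count-≤-length p []      = z≤n
  count-≤-length p (a ∷ l) with p a
  ... | true  = s≤s (count-≤-length p l)
  ... | false = ≤-trans (count-≤-length p l) (n≤1+n _)

injective⇒surjective : ∀ {n} (h : Fin n → Fin n) → (∀ {i j} → h i ≡ h j → i ≡ j) → ∀ p → ∃ λ i → h i ≡ p
injective⇒surjective {suc m} h h-inj p with Finₚ.any? (λ i → h i Finₚ.≟ p)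
... | yes found = found
... | no ¬found = ⊥-elim (1+n≰n (injective⇒≤ {f = missing-p} missing-p-injective))
  where
  missing-p : Fin (suc m) → Fin m
  missing-p i = Fin.punchOut {i = p} {j = h i} (λ e → ¬found (i , sym e))
  missing-p-injective : ∀ {i j} → missing-p i ≡ missing-p j → i ≡ j
  missing-p-injective {i} {j} e = h-inj (punchOut-injective (λ e′ → ¬found (i , sym e′)) (λ e′ → ¬found (j , sym e′)) e)

injective⇒permutation : ∀ {n} (h : Fin n → Fin n) → (∀ {i j} → h i ≡ h j → i ≡ j) →
                        Σ (Permutation′ n) λ π → ∀ i → π ⟨$⟩ˡ i ≡ h i
injective⇒permutation h h-inj = permutation h⁻¹ h (λ i → h-inj (h∘h⁻¹ (h i))) h∘h⁻¹ , λ _ → refl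
  where
  h⁻¹ : Fin _ → Fin _
  h⁻¹ p = proj₁ (injective⇒surjective h h-inj p)
  h∘h⁻¹ : ∀ p → h (h⁻¹ p) ≡ p
  h∘h⁻¹ p = proj₂ (injective⇒surjective h h-inj p)

𝟙≤-yes : ∀ {a b} → a ≤ b → 𝟙 ⌊ a ≤? b ⌋ ≡ 1
𝟙≤-yes {a} {b} a≤b with a ≤? b
... | yes _   = refl
... | no a≰b = ⊥-elim (a≰b a≤b)

𝟙≤-no : ∀ {a b} → ¬ a ≤ b → 𝟙 ⌊ a ≤? b ⌋ ≡ 0
𝟙≤-no {a} {b} a≰b with a ≤? b
... | yes a≤b = ⊥-elim (a≰b a≤b)
... | no _    = refl

+𝟙≤suc : ∀ v b → v + 𝟙 b ≤ suc v
+𝟙≤suc v true  = ≤-reflexive (+-comm v 1)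
+𝟙≤suc v false = ≤-trans (≤-reflexive (+-identityʳ v)) (n≤1+n v)

𝟙≤-monoˡ : ∀ {a a′} b → a′ ≤ a → 𝟙 ⌊ a ≤? b ⌋ ≤ 𝟙 ⌊ a′ ≤? b ⌋
𝟙≤-monoˡ {a} {a′} b a′≤a = 𝟙-mono {⌊ a ≤? b ⌋} {⌊ a′ ≤? b ⌋} (λ t → fromWitness (≤-trans a′≤a (toWitness {a? = a ≤? b} t)))

𝟙≤-monoʳ : ∀ a {b b′} → b ≤ b′ → 𝟙 ⌊ a ≤? b ⌋ ≤ 𝟙 ⌊ a ≤? b′ ⌋
𝟙≤-monoʳ a {b} {b′} b≤b′ = 𝟙-mono {⌊ a ≤? b ⌋} {⌊ a ≤? b′ ⌋} (λ t → fromWitness (≤-trans (toWitness {a? = a ≤? b} t) b≤b′))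

lookup-vert : ∀ {n} (v : Vec ℕ n) π m i → lookup (vert v π m) i ≡ lookup v i + 𝟙 ⌊ n ∸ m ≤? Fin.toℕ (pos π i) ⌋
lookup-vert v π m i = lookup∘tabulate _ i

vert-step : ∀ {n} (v : Vec ℕ n) π {m m′} → m ≤ m′ → Step (toList (vert v π m)) (toList (vert v π m′))
vert-step {n} v π {m} {m′} m≤m′ =
  toList-pointwise⁺ (vert v π m) (vert v π m′) (λ i → subst₂ _≤_ (sym (lookup-vert v π m i)) (sym (lookup-vert v π m′ i))
    (+-monoʳ-≤ (lookup v i) (𝟙≤-monoˡ _ (∸-monoʳ-≤ n m≤m′)))) ,
  ≼-sucs⁺ (toList-pointwise⁺ (vert v π m) (vert v π m′) (λ i → subst₂ (λ a b → b ≤ suc a) (sym (lookup-vert v π m i)) (sym (lookup-vert v π m′ i))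
    (≤-trans (+𝟙≤suc (lookup v i) _) (s≤s (m≤m+n (lookup v i) _)))))

T-face⇒Flag : ∀ {n q} xs → face (T (suc n) q) xs → face (Flag (Tᴳ n q)) xs
T-face⇒Flag xs (v , π , (_ , _ , vertsInW) , isVert) = All.map vtx isVert , adj
  where
  vtx : ∀ {x} → IsVertexOf v π x → Vtx (Tᴳ _ _) x
  vtx (m , m≤n , refl) = InW⇒Vtx _ (vertsInW m m≤n)
  adj : ∀ {x y} → x ∈ xs → y ∈ xs → Comparable (toList x) (toList y)
  adj x∈ y∈ with All.lookup isVert x∈ | All.lookup isVert y∈
  ... | m , _ , refl | m′ , _ , refl = Sum.map (vert-step v π) (vert-step v π) (≤-total m m′)

if-T : ∀ {A : Set} b {x y : A} → Tᵇ b → (if b then x else y) ≡ x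
if-T true _ = refl

if-¬T : ∀ {A : Set} b {x y : A} → ¬ Tᵇ b → (if b then x else y) ≡ y
if-¬T true  ¬b = ⊥-elim (¬b tt)
if-¬T false _  = refl

∨-not-elim : ∀ {b c} → ¬ Tᵇ b → Tᵇ (b ∨ not c) → ¬ Tᵇ c
∨-not-elim {true}          ¬b _  = ⊥-elim (¬b tt)
∨-not-elim {false} {true}  _  () _
∨-not-elim {false} {false} _  _  ()

¬∨-not : ∀ {b c} → ¬ Tᵇ (b ∨ not c) → ¬ Tᵇ b × Tᵇ c
¬∨-not {true}          ¬b∨ = ⊥-elim (¬b∨ tt)
¬∨-not {false} {true}  _   = (λ ()) , tt
¬∨-not {false} {false} ¬b∨ = ⊥-elim (¬b∨ tt)

¬T⇒Tnot : ∀ {b} → ¬ Tᵇ b → Tᵇ (not b)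
¬T⇒Tnot {true}  ¬b = ¬b tt
¬T⇒Tnot {false} _  = tt

Tnot⇒¬T : ∀ {b} → Tᵇ (not b) → ¬ Tᵇ b
Tnot⇒¬T {true} ()

suc-∸1 : ∀ {q} → 1 ≤ q → suc (q ∸ 1) ≡ q
suc-∸1 (s≤s z≤n) = refl

-- The facet F(v, π) containing the clique S: v is the coordinatewise minimum of S, lowered by one where it
-- equals q; coordinates are raised in increasing order of the key (weight, reversed index), where the weight of
-- a coordinate i counts the members of S attaining the minimum at i (weight 0 if the minimum is q).  A member t
-- of S is then the vertex whose raised set is {i : t_i ≠ v_i}.
module CliqueFacet {n q : ℕ} (q≥1 : 1 ≤ q) (S : List (Vec ℕ n)) (s : Vec ℕ n) (s∈S : s ∈ S)
                   (vS : All (Vtx (Tᴳ n q)) S) (aS : ∀ {x y} → x ∈ S → y ∈ S → Adj (Tᴳ n q) x y) where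

  member-InW : ∀ {t} → t ∈ S → InW q t
  member-InW t∈ = Vtx⇒InW _ (All.lookup vS t∈)

  member-mono : ∀ {t} → t ∈ S → ∀ i j → Fin.toℕ i ≤ Fin.toℕ j → lookup t i ≤ lookup t j
  member-mono t∈ = proj₁ (member-InW t∈)

  member-≤q : ∀ {t} → t ∈ S → ∀ i → lookup t i ≤ q
  member-≤q t∈ = proj₂ (member-InW t∈)

  members-≤ : ∀ {t u} → t ∈ S → u ∈ S → (∀ i → lookup t i ≤ lookup u i) ⊎ (∀ i → lookup u i ≤ lookup t i)
  members-≤ {t} {u} t∈ u∈ = Sum.map (λ (t≼u , _) → toList-pointwise⁻ t u t≼u) (λ (u≼t , _) → toList-pointwise⁻ u t u≼t) (aS t∈ u∈)

  members-≤suc : ∀ {t u} → t ∈ S → u ∈ S → ∀ i → lookup t i ≤ suc (lookup u i)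
  members-≤suc {t} {u} t∈ u∈ i with aS t∈ u∈
  ... | inj₁ (t≼u , _)  = ≤-trans (toList-pointwise⁻ t u t≼u i) (n≤1+n _)
  ... | inj₂ (_ , t≼su) = toList-pointwise⁻ u t (≼-sucs⁻ t≼su) i

  minAt : Fin n → List (Vec ℕ n) → ℕ
  minAt i []      = lookup s i
  minAt i (t ∷ l) = lookup t i ⊓ minAt i l

  minAt-≤ : ∀ i {l t} → t ∈ l → minAt i l ≤ lookup t i
  minAt-≤ i (here refl) = m⊓n≤m _ _
  minAt-≤ i (there t∈)  = ≤-trans (m⊓n≤n _ _) (minAt-≤ i t∈)

  minAt-glb : ∀ i {c} l → c ≤ lookup s i → (∀ {t} → t ∈ l → c ≤ lookup t i) → c ≤ minAt i l
  minAt-glb i []      c≤s c≤l = c≤s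
  minAt-glb i (t ∷ l) c≤s c≤l = ⊓-glb (c≤l (here refl)) (minAt-glb i l c≤s (λ t∈ → c≤l (there t∈)))

  minAt-attained : ∀ i l → minAt i l ≡ lookup s i ⊎ ∃ λ t → t ∈ l × minAt i l ≡ lookup t i
  minAt-attained i []      = inj₁ refl
  minAt-attained i (t ∷ l) with ⊓-sel (lookup t i) (minAt i l)
  ... | inj₁ e = inj₂ (t , here refl , e)
  ... | inj₂ e = Sum.map (trans e) (λ (u , u∈ , e′) → u , there u∈ , trans e e′) (minAt-attained i l)

  low : Fin n → ℕ
  low i = minAt i S

  low-≤ : ∀ {t} → t ∈ S → ∀ i → low i ≤ lookup t i
  low-≤ t∈ i = minAt-≤ i t∈

  low-attained : ∀ i → ∃ λ t → t ∈ S × low i ≡ lookup t i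
  low-attained i with minAt-attained i S
  ... | inj₁ e        = s , s∈S , e
  ... | inj₂ attained = attained

  low-mono : ∀ i j → Fin.toℕ i ≤ Fin.toℕ j → low i ≤ low j
  low-mono i j i≤j = minAt-glb j S (≤-trans (low-≤ s∈S i) (member-mono s∈S i j i≤j))
                                   (λ t∈ → ≤-trans (low-≤ t∈ i) (member-mono t∈ i j i≤j))

  low-≤q : ∀ i → low i ≤ q
  low-≤q i with low-attained i
  ... | t , t∈ , e = subst (_≤ q) (sym e) (member-≤q t∈ i)

  member-≤suc-low : ∀ {t} → t ∈ S → ∀ i → lookup t i ≤ suc (low i)
  member-≤suc-low t∈ i with low-attained i
  ... | u , u∈ , e = subst (λ z → _ ≤ suc z) (sym e) (members-≤suc t∈ u∈ i)

  atTop : Fin n → Bool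
  atTop i = low i ≡ᵇ q

  atTop⇒ : ∀ {i} → Tᵇ (atTop i) → low i ≡ q
  atTop⇒ {i} = ≡ᵇ⇒≡ (low i) q

  ⇒atTop : ∀ {i} → low i ≡ q → Tᵇ (atTop i)
  ⇒atTop {i} = ≡⇒≡ᵇ (low i) q

  ¬atTop⇒low<q : ∀ {i} → ¬ Tᵇ (atTop i) → low i < q
  ¬atTop⇒low<q {i} ¬top = ≤∧≢⇒< (low-≤q i) (λ e → ¬top (⇒atTop e))

  atLow : Vec ℕ n → Fin n → Bool
  atLow t i = lookup t i ≡ᵇ low i

  #atLow : Fin n → ℕ
  #atLow i = count (λ t → atLow t i) S

  weight : Fin n → ℕ
  weight i = if atTop i then 0 else suc (#atLow i)

  base : Fin n → ℕ
  base i = low i ∸ 𝟙 (atTop i)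

  v : Vec ℕ n
  v = tabulate base

  base-atTop : ∀ {i} → Tᵇ (atTop i) → base i ≡ q ∸ 1
  base-atTop {i} top = trans (cong (low i ∸_) (if-T (atTop i) top)) (cong (_∸ 1) (atTop⇒ top))

  base-¬atTop : ∀ {i} → ¬ Tᵇ (atTop i) → base i ≡ low i
  base-¬atTop {i} ¬top = cong (low i ∸_) (if-¬T (atTop i) ¬top)

  weight-atTop : ∀ {i} → Tᵇ (atTop i) → weight i ≡ 0
  weight-atTop {i} = if-T (atTop i)

  weight-¬atTop : ∀ {i} → ¬ Tᵇ (atTop i) → weight i ≡ suc (#atLow i)
  weight-¬atTop {i} = if-¬T (atTop i)

  atTop-upward : ∀ {i j} → Fin.toℕ i ≤ Fin.toℕ j → Tᵇ (atTop i) → Tᵇ (atTop j)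
  atTop-upward {i} {j} i≤j top = ⇒atTop (≤-antisym (low-≤q j) (subst (_≤ low j) (atTop⇒ top) (low-mono i j i≤j)))

  base-mono : ∀ i j → Fin.toℕ i ≤ Fin.toℕ j → base i ≤ base j
  base-mono i j i≤j with T? (atTop i) | T? (atTop j)
  ... | yes ti | yes tj = ≤-reflexive (trans (base-atTop ti) (sym (base-atTop tj)))
  ... | yes ti | no ¬tj = ⊥-elim (¬tj (atTop-upward i≤j ti))
  ... | no ¬ti | yes tj = subst₂ _≤_ (sym (base-¬atTop ¬ti)) (sym (base-atTop tj))
                            (≤-pred (subst (suc (low i) ≤_) (sym (suc-∸1 q≥1)) (¬atTop⇒low<q ¬ti)))
  ... | no ¬ti | no ¬tj = subst₂ _≤_ (sym (base-¬atTop ¬ti)) (sym (base-¬atTop ¬tj)) (low-mono i j i≤j)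

  base<q : ∀ i → base i < q
  base<q i with T? (atTop i)
  ... | yes ti  = ≤-reflexive (trans (cong suc (base-atTop ti)) (suc-∸1 q≥1))
  ... | no ¬ti = subst (_< q) (sym (base-¬atTop ¬ti)) (¬atTop⇒low<q ¬ti)

  weight-antitone-on-ties : ∀ i j → Fin.toℕ i < Fin.toℕ j → base i ≡ base j → weight j ≤ weight i
  weight-antitone-on-ties i j i<j e with T? (atTop i) | T? (atTop j)
  ... | _      | yes tj = subst (_≤ weight i) (sym (weight-atTop tj)) z≤n
  ... | yes ti | no ¬tj = ⊥-elim (¬tj (atTop-upward (<⇒≤ i<j) ti))
  ... | no ¬ti | no ¬tj = subst₂ _≤_ (sym (weight-¬atTop ¬tj)) (sym (weight-¬atTop ¬ti)) (s≤s (≮⇒≥ fewer-at-i))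
    where
    low-tie : low i ≡ low j
    low-tie = trans (sym (base-¬atTop ¬ti)) (trans e (base-¬atTop ¬tj))
    fewer-at-i : ¬ #atLow i < #atLow j
    fewer-at-i lt with count-witness (λ t → atLow t i) (λ t → atLow t j) S lt
    ... | t , t∈ , t-low-j , t-not-low-i = <-irrefl refl (begin-strict
      low i       <⟨ ≤∧≢⇒< (low-≤ t∈ i) (λ e → t-not-low-i (≡⇒≡ᵇ _ _ (sym e))) ⟩
      lookup t i  ≤⟨ member-mono t∈ i j (<⇒≤ i<j) ⟩
      lookup t j  ≡⟨ ≡ᵇ⇒≡ _ _ t-low-j ⟩
      low j       ≡⟨ sym low-tie ⟩
      low i       ∎)
      where open ≤-Reasoning

  key : Fin n → ℕ
  key i = weight i ℕ.* n + (n ∸ suc (Fin.toℕ i))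

  reversed-index<n : ∀ (i : Fin n) → n ∸ suc (Fin.toℕ i) < n
  reversed-index<n i = go n (Fin.toℕ i) (Finₚ.toℕ<n i)
    where
    go : ∀ m a → a < m → m ∸ suc a < m
    go (suc m) a _ = s≤s (m∸n≤m m a)

  key-<-weight : ∀ {i j} → weight j < weight i → key j < key i
  key-<-weight {i} {j} wj<wi = begin-strict
    weight j ℕ.* n + (n ∸ suc (Fin.toℕ j)) <⟨ +-monoʳ-< (weight j ℕ.* n) (reversed-index<n j) ⟩
    weight j ℕ.* n + n                     ≡⟨ +-comm (weight j ℕ.* n) n ⟩
    suc (weight j) ℕ.* n                   ≤⟨ *-monoˡ-≤ n wj<wi ⟩
    weight i ℕ.* n                         ≤⟨ m≤m+n (weight i ℕ.* n) _ ⟩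
    key i                                  ∎
    where open ≤-Reasoning

  key-<-index : ∀ {i j} → weight j ≡ weight i → Fin.toℕ i < Fin.toℕ j → key j < key i
  key-<-index {i} {j} wj≡wi i<j = subst (λ w → w ℕ.* n + (n ∸ suc (Fin.toℕ j)) < key i) (sym wj≡wi)
    (+-monoʳ-< (weight i ℕ.* n) (∸-monoʳ-< (s≤s i<j) (Finₚ.toℕ<n j)))

  key-injective : ∀ {i j} → key i ≡ key j → i ≡ j
  key-injective {i} {j} e with <-cmp (weight i) (weight j)
  ... | tri< wi<wj _ _ = ⊥-elim (<⇒≢ (key-<-weight wi<wj) e)
  ... | tri> _ _ wj<wi = ⊥-elim (<⇒≢ (key-<-weight wj<wi) (sym e))
  ... | tri≈ _ wi≡wj _ = Finₚ.toℕ-injective (suc-injective (∸-cancelˡ-≡ (Finₚ.toℕ<n i) (Finₚ.toℕ<n j)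
                           (+-cancelˡ-≡ (weight i ℕ.* n) _ _ (trans e (cong (λ w → w ℕ.* n + _) (sym wi≡wj))))))

  key-trichotomy : ∀ {i j} → i ≢ j → key i < key j ⊎ key j < key i
  key-trichotomy {i} {j} i≢j with <-cmp (key i) (key j)
  ... | tri< lt _ _ = inj₁ lt
  ... | tri≈ _ e _  = ⊥-elim (i≢j (key-injective e))
  ... | tri> _ _ gt = inj₂ gt

  key-<⇒weight-≤ : ∀ {i j} → key j < key i → weight j ≤ weight i
  key-<⇒weight-≤ kj<ki = ≮⇒≥ (λ wi<wj → <-asym (key-<-weight wi<wj) kj<ki)

  key-<-on-ties : ∀ i j → Fin.toℕ i < Fin.toℕ j → base i ≡ base j → key j < key i
  key-<-on-ties i j i<j e with m≤n⇒m<n∨m≡n (weight-antitone-on-ties i j i<j e)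
  ... | inj₁ wj<wi = key-<-weight wj<wi
  ... | inj₂ wj≡wi = key-<-index wj≡wi i<j

  rank : Fin n → ℕ
  rank i = count (λ l → key i <ᵇ key l) (allFin n)

  length-allFin : length (allFin n) ≡ n
  length-allFin = length-tabulate (λ i → i)

  rank<n : ∀ i → rank i < n
  rank<n i = subst (rank i <_) (trans (count-true (allFin n)) length-allFin)
    (count-< (λ l → key i <ᵇ key l) (λ _ → true) (allFin n) (λ _ _ → tt) (∈-allFin i) tt
       (λ t → <-irrefl refl (<ᵇ⇒< (key i) (key i) t)))
    where
    count-true : ∀ {A : Set} (l : List A) → count (λ _ → true) l ≡ length l
    count-true []      = refl
    count-true (a ∷ l) = cong suc (count-true l)

  rank-< : ∀ {i j} → key j < key i → rank i < rank j
  rank-< {i} {j} kj<ki = count-< (λ l → key i <ᵇ key l) (λ l → key j <ᵇ key l) (allFin n)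
    (λ {l} _ t → <⇒<ᵇ (<-trans kj<ki (<ᵇ⇒< (key i) (key l) t))) (∈-allFin i) (<⇒<ᵇ kj<ki)
    (λ t → <-irrefl refl (<ᵇ⇒< (key i) (key i) t))

  rankFin : Fin n → Fin n
  rankFin i = Fin.fromℕ< (rank<n i)

  toℕ-rankFin : ∀ i → Fin.toℕ (rankFin i) ≡ rank i
  toℕ-rankFin i = Finₚ.toℕ-fromℕ< (rank<n i)

  rankFin-injective : ∀ {i j} → rankFin i ≡ rankFin j → i ≡ j
  rankFin-injective {i} {j} e with i Finₚ.≟ j
  ... | yes i≡j = i≡j
  ... | no i≢j  = ⊥-elim (Sum.[ (λ ki<kj → <⇒≢ (rank-< ki<kj) (sym rank-eq)) , (λ kj<ki → <⇒≢ (rank-< kj<ki) rank-eq) ]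
                            (key-trichotomy i≢j))
    where
    rank-eq : rank i ≡ rank j
    rank-eq = trans (sym (toℕ-rankFin i)) (trans (cong Fin.toℕ e) (toℕ-rankFin j))

  π : Permutation′ n
  π = proj₁ (injective⇒permutation rankFin rankFin-injective)

  pos-π : ∀ i → Fin.toℕ (pos π i) ≡ rank i
  pos-π i = trans (cong Fin.toℕ (proj₂ (injective⇒permutation rankFin rankFin-injective) i)) (toℕ-rankFin i)

  lookup-v : ∀ i → lookup v i ≡ base i
  lookup-v i = lookup∘tabulate base i

  lookup-vert-v : ∀ m i → lookup (vert v π m) i ≡ base i + 𝟙 ⌊ n ∸ m ≤? rank i ⌋
  lookup-vert-v m i = trans (lookup-vert v π m i) (cong₂ (λ a r → a + 𝟙 ⌊ n ∸ m ≤? r ⌋) (lookup-v i) (pos-π i))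

  v-π-consistent : Consistent v π
  v-π-consistent i j j≡1+i vi≡vj = subst₂ _<_ (sym (pos-π i)) (sym (pos-π j))
    (rank-< (key-<-on-ties i j (≤-reflexive (sym j≡1+i)) (trans (sym (lookup-v i)) (trans vi≡vj (lookup-v j)))))

  v-InW : InW q v
  v-InW = (λ i j i≤j → subst₂ _≤_ (sym (lookup-v i)) (sym (lookup-v j)) (base-mono i j i≤j))
        , (λ i → subst (_≤ q) (sym (lookup-v i)) (<⇒≤ (base<q i)))

  vert-InW : ∀ m → m ≤ n → InW q (vert v π m)
  vert-InW m _ = mono , bounded
    where
    mono : ∀ i j → Fin.toℕ i ≤ Fin.toℕ j → lookup (vert v π m) i ≤ lookup (vert v π m) j
    mono i j i≤j rewrite lookup-vert-v m i | lookup-vert-v m j with m≤n⇒m<n∨m≡n i≤j | m≤n⇒m<n∨m≡n (base-mono i j i≤j)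
    ... | inj₂ i≡j | _ = ≤-reflexive (cong (λ k → base k + 𝟙 ⌊ n ∸ m ≤? rank k ⌋) (Finₚ.toℕ-injective i≡j))
    ... | inj₁ _   | inj₁ bi<bj = ≤-trans (+𝟙≤suc (base i) _) (≤-trans bi<bj (m≤m+n (base j) _))
    ... | inj₁ i<j | inj₂ bi≡bj = subst (λ b → b + 𝟙 ⌊ n ∸ m ≤? rank i ⌋ ≤ base j + 𝟙 ⌊ n ∸ m ≤? rank j ⌋) (sym bi≡bj)
                                    (+-monoʳ-≤ (base j) (𝟙≤-monoʳ (n ∸ m) (<⇒≤ (rank-< (key-<-on-ties i j i<j bi≡bj)))))
    bounded : ∀ i → lookup (vert v π m) i ≤ q
    bounded i rewrite lookup-vert-v m i = ≤-trans (+𝟙≤suc (base i) _) (base<q i)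

  module MemberIsVertex {t : Vec ℕ n} (t∈ : t ∈ S) where

    raised : Fin n → Bool
    raised i = atTop i ∨ not (atLow t i)

    lookup-raised : ∀ i → Tᵇ (raised i) → lookup t i ≡ suc (base i)
    lookup-raised i r with T? (atTop i)
    ... | yes top = trans (≤-antisym (member-≤q t∈ i) (subst (_≤ lookup t i) (atTop⇒ top) (low-≤ t∈ i)))
                          (sym (trans (cong suc (base-atTop top)) (suc-∸1 q≥1)))
    ... | no ¬top = ≤-antisym (subst (λ b → lookup t i ≤ suc b) (sym (base-¬atTop ¬top)) (member-≤suc-low t∈ i))
                              (subst (λ b → suc b ≤ lookup t i) (sym (base-¬atTop ¬top))
                                (≤∧≢⇒< (low-≤ t∈ i) (λ e → ∨-not-elim ¬top r (≡⇒≡ᵇ _ _ (sym e)))))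

    lookup-unraised : ∀ i → ¬ Tᵇ (raised i) → lookup t i ≡ base i
    lookup-unraised i ¬r = trans (≡ᵇ⇒≡ _ _ (proj₂ (¬∨-not ¬r))) (sym (base-¬atTop (proj₁ (¬∨-not ¬r))))

    -- If t were raised at i but not at j, every member of S at its minimum in coordinate i would also be at
    -- its minimum in coordinate j, and t would be one more: #atLow i < #atLow j, against weight j ≤ weight i.
    raised-closed : ∀ {i j} → Tᵇ (raised i) → key j < key i → Tᵇ (raised j)
    raised-closed {i} {j} ri kj<ki with T? (raised j)
    ... | yes rj  = rj
    ... | no ¬rj = ⊥-elim (≤⇒≯ #j≤#i (count-< _ _ S low-i⇒low-j t∈ t-low-j t-not-low-i))
      where
      ¬top-j : ¬ Tᵇ (atTop j)
      ¬top-j = proj₁ (¬∨-not ¬rj)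
      t-low-j : Tᵇ (atLow t j)
      t-low-j = proj₂ (¬∨-not ¬rj)
      wj≤wi : weight j ≤ weight i
      wj≤wi = key-<⇒weight-≤ kj<ki
      ¬top-i : ¬ Tᵇ (atTop i)
      ¬top-i top-i = <⇒≱ (subst (0 <_) (sym (weight-¬atTop ¬top-j)) (s≤s z≤n)) (subst (weight j ≤_) (weight-atTop top-i) wj≤wi)
      #j≤#i : #atLow j ≤ #atLow i
      #j≤#i = ≤-pred (subst₂ _≤_ (weight-¬atTop ¬top-j) (weight-¬atTop ¬top-i) wj≤wi)
      t-not-low-i : ¬ Tᵇ (atLow t i)
      t-not-low-i = ∨-not-elim ¬top-i ri
      low-i⇒low-j : ∀ {u} → u ∈ S → Tᵇ (atLow u i) → Tᵇ (atLow u j)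
      low-i⇒low-j {u} u∈ u-low-i with lookup u j ℕ.≟ low j | members-≤ u∈ t∈
      ... | yes e   | _        = ≡⇒≡ᵇ _ _ e
      ... | no uj≢ | inj₁ u≤t = ⊥-elim (uj≢ (≤-antisym (subst (lookup u j ≤_) (≡ᵇ⇒≡ _ _ t-low-j) (u≤t j)) (low-≤ u∈ j)))
      ... | no _    | inj₂ t≤u = ⊥-elim (t-not-low-i (≡⇒≡ᵇ _ _
                                   (≤-antisym (subst (lookup t i ≤_) (≡ᵇ⇒≡ _ _ u-low-i) (t≤u i)) (low-≤ t∈ i))))

    #raised : ℕ
    #raised = count raised (allFin n)

    #raised≤n : #raised ≤ n
    #raised≤n = subst (#raised ≤_) length-allFin (count-≤-length raised (allFin n))

    #unraised : n ∸ #raised ≡ count (λ l → not (raised l)) (allFin n)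
    #unraised = trans (cong (_∸ #raised) (trans (sym length-allFin) (sym (count-complement raised (allFin n)))))
                      (m+n∸m≡n #raised _)

    raised⇒rank-≥ : ∀ {i} → Tᵇ (raised i) → n ∸ #raised ≤ rank i
    raised⇒rank-≥ {i} ri = subst (_≤ rank i) (sym #unraised) (count-mono _ _ (allFin n) unraised⇒above)
      where
      unraised⇒above : ∀ {l} → l ∈ allFin n → Tᵇ (not (raised l)) → Tᵇ (key i <ᵇ key l)
      unraised⇒above {l} _ ¬rl with i Finₚ.≟ l
      ... | yes refl = ⊥-elim (Tnot⇒¬T ¬rl ri)
      ... | no i≢l with key-trichotomy i≢l
      ...   | inj₁ ki<kl = <⇒<ᵇ ki<kl
      ...   | inj₂ kl<ki = ⊥-elim (Tnot⇒¬T ¬rl (raised-closed ri kl<ki))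

    unraised⇒rank-< : ∀ {i} → ¬ Tᵇ (raised i) → rank i < n ∸ #raised
    unraised⇒rank-< {i} ¬ri = subst (rank i <_) (sym #unraised)
      (count-< _ _ (allFin n) above⇒unraised (∈-allFin i) (¬T⇒Tnot ¬ri) (λ t → <-irrefl refl (<ᵇ⇒< (key i) (key i) t)))
      where
      above⇒unraised : ∀ {l} → l ∈ allFin n → Tᵇ (key i <ᵇ key l) → Tᵇ (not (raised l))
      above⇒unraised {l} _ ki<kl with T? (raised l)
      ... | yes rl  = ⊥-elim (¬ri (raised-closed rl (<ᵇ⇒< (key i) (key l) ki<kl)))
      ... | no ¬rl = ¬T⇒Tnot ¬rl

    lookup-member : ∀ i → lookup t i ≡ lookup (vert v π #raised) i
    lookup-member i with T? (raised i)
    ... | yes ri  = begin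
      lookup t i                                     ≡⟨ lookup-raised i ri ⟩
      suc (base i)                                   ≡⟨ +-comm 1 (base i) ⟩
      base i + 1                                     ≡⟨ cong (base i +_) (sym (𝟙≤-yes (raised⇒rank-≥ ri))) ⟩
      base i + 𝟙 ⌊ n ∸ #raised ≤? rank i ⌋           ≡⟨ sym (lookup-vert-v #raised i) ⟩
      lookup (vert v π #raised) i                    ∎
      where open ≡-Reasoning
    ... | no ¬ri = begin
      lookup t i                                     ≡⟨ lookup-unraised i ¬ri ⟩
      base i                                         ≡⟨ sym (+-identityʳ (base i)) ⟩
      base i + 0                                     ≡⟨ cong (base i +_) (sym (𝟙≤-no (<⇒≱ (unraised⇒rank-< ¬ri)))) ⟩
      base i + 𝟙 ⌊ n ∸ #raised ≤? rank i ⌋           ≡⟨ sym (lookup-vert-v #raised i) ⟩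
      lookup (vert v π #raised) i                    ∎
      where open ≡-Reasoning

    isVertex : IsVertexOf v π t
    isVertex = #raised , #raised≤n , trans (sym (tabulate∘lookup t)) (trans (tabulate-cong lookup-member) (tabulate∘lookup _))

  isFacet : IsFacet q v π
  isFacet = v-InW , v-π-consistent , vert-InW

  allVertices : All (IsVertexOf v π) S
  allVertices = All.tabulate (λ t∈ → MemberIsVertex.isVertex t∈)

≼-sucs : ∀ l → l ≼ sucs l
≼-sucs []      = []
≼-sucs (a ∷ l) = n≤1+n a ∷ ≼-sucs l

Flag-face⇒T : ∀ {n q} → 1 ≤ q → ∀ xs → face (Flag (Tᴳ n q)) xs → face (T (suc n) q) xs
Flag-face⇒T {n} {q} q≥1 [] _ = v , π , isFacet , []
  where
  0ⁿ : Vec ℕ n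
  0ⁿ = tabulate (λ _ → 0)
  0ⁿ-vtx : Vtx (Tᴳ n q) 0ⁿ
  0ⁿ-vtx = InW⇒Vtx 0ⁿ ( (λ i j _ → ≤-reflexive (trans (lookup∘tabulate _ i) (sym (lookup∘tabulate _ j))))
                       , (λ i → subst (_≤ q) (sym (lookup∘tabulate _ i)) z≤n))
  0ⁿ-adj : ∀ {x y} → x ∈ [ 0ⁿ ] → y ∈ [ 0ⁿ ] → Adj (Tᴳ n q) x y
  0ⁿ-adj (here refl) (here refl) = inj₁ (≼-refl , ≼-sucs (toList 0ⁿ))
  open CliqueFacet q≥1 [ 0ⁿ ] 0ⁿ (here refl) (0ⁿ-vtx ∷ []) 0ⁿ-adj
Flag-face⇒T q≥1 (s ∷ ss) (vs , as) = v , π , isFacet , allVertices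
  where open CliqueFacet q≥1 (s ∷ ss) s (here refl) vs as

link-T≅link-Flag : ∀ {n q} → 1 ≤ q → ∀ F → link (T (suc n) q) F ≅ link (Flag (Tᴳ n q)) F
link-T≅link-Flag q≥1 F = ≅-sameFaces _ _
  (λ τ (τ-face , τF-face , τ∉F) → T-face⇒Flag τ τ-face , T-face⇒Flag (τ ++ F) τF-face , τ∉F)
  (λ τ (τ-face , τF-face , τ∉F) → Flag-face⇒T q≥1 τ τ-face , Flag-face⇒T q≥1 (τ ++ F) τF-face , τ∉F)

-- Links of vertices of T_{k,q}

preds : List ℕ → List ℕ
preds = map ℕ.pred

preds-sucs : ∀ l → preds (sucs l) ≡ l
preds-sucs []      = refl
preds-sucs (a ∷ l) = cong (a ∷_) (preds-sucs l)

sucs-preds : ∀ {l} → All (1 ≤_) l → sucs (preds l) ≡ l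
sucs-preds []                 = refl
sucs-preds {suc a ∷ l} (_ ∷ ps) = cong (suc a ∷_) (sucs-preds ps)

sucs-injective : ∀ {a b} → sucs a ≡ sucs b → a ≡ b
sucs-injective {a} {b} e = trans (sym (preds-sucs a)) (trans (cong preds e) (preds-sucs b))

sucs-mono : ∀ {a b} → a ≼ b → sucs a ≼ sucs b
sucs-mono []       = []
sucs-mono (p ∷ ps) = s≤s p ∷ sucs-mono ps

preds-mono : ∀ {a b} → a ≼ b → preds a ≼ preds b
preds-mono []       = []
preds-mono (p ∷ ps) = pred-mono-≤ p ∷ preds-mono ps

ascending-map : ∀ {f : ℕ → ℕ} → (∀ {a b} → a ≤ b → f a ≤ f b) → ∀ {l} → Ascending l → Ascending (map f l)
ascending-map f-mono = Linkedₚ.map⁺ ∘ Linked.map f-mono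

All-≤-sucs : ∀ {q} l → All (_≤ q) l → All (_≤ suc q) (sucs l)
All-≤-sucs [] [] = []
All-≤-sucs (_ ∷ l) (p ∷ ps) = s≤s p ∷ All-≤-sucs l ps

All-≤-preds : ∀ {q} {l} → All (_≤ suc q) l → All (_≤ q) (preds l)
All-≤-preds []       = []
All-≤-preds (p ∷ ps) = pred-mono-≤ p ∷ All-≤-preds ps

sucs-positive : ∀ l → All (1 ≤_) (sucs l)
sucs-positive []      = []
sucs-positive (a ∷ l) = s≤s z≤n ∷ sucs-positive l

vecOf : (n : ℕ) → List ℕ → Vec ℕ n
vecOf zero    _       = []
vecOf (suc n) []      = 0 ∷ vecOf n []
vecOf (suc n) (a ∷ l) = a ∷ vecOf n l

toList-vecOf : ∀ n l → length l ≡ n → toList (vecOf n l) ≡ l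
toList-vecOf zero    []      _ = refl
toList-vecOf (suc n) (a ∷ l) e = cong (a ∷_) (toList-vecOf n l (suc-injective e))

vecOf-toList : ∀ {n} (y : Vec ℕ n) → vecOf n (toList y) ≡ y
vecOf-toList []      = refl
vecOf-toList (a ∷ y) = cong (a ∷_) (vecOf-toList y)

toList-injective : ∀ {n} (x y : Vec ℕ n) → toList x ≡ toList y → x ≡ y
toList-injective x y e = trans (sym (vecOf-toList x)) (trans (cong (vecOf _) e) (vecOf-toList y))

first : List ℕ → ℕ
first []      = 0
first (a ∷ _) = a

SpreadBoxᴳ : ℕ → List ℕ → Graph
SpreadBoxᴳ q u = record
  { Carrier = List ℕ
  ; Vtx = λ z → Ascending z × u ≼ z × z ≼ sucs u × All (_≤ first z + q) z × z ≢ u × z ≢ sucs u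
  ; Adj = λ z z′ → z ≼ z′ ⊎ z′ ≼ z }

Boxᴳ : List ℕ → Graph
Boxᴳ u = record
  { Carrier = List ℕ
  ; Vtx = λ z → Ascending z × u ≼ z × z ≼ sucs u × z ≢ u × z ≢ sucs u
  ; Adj = λ z z′ → z ≼ z′ ⊎ z′ ≼ z }

-- A neighbour y of x lies either above x (X ≼ y ≼ X + 1) or below it (y ≼ X ≼ y + 1); prefixing 0 to the
-- former and 1 to the successor of the latter places both strictly between 0 ∷ X and 1 ∷ (X + 1).
module VertexLinkᵀ {n q : ℕ} (x : Vec ℕ n) (vx : Vtx (Tᴳ n q) x) where

  X : List ℕ
  X = toList x

  InLink : Vec ℕ n → Set
  InLink = Vtx (linkᴳ (Tᴳ n q) [ x ])

  lift : Vec ℕ n → List ℕ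
  lift y with X ≼? toList y
  ... | yes _ = 0 ∷ toList y
  ... | no _  = 1 ∷ sucs (toList y)

  unlift : List ℕ → Vec ℕ n
  unlift []          = vecOf n []
  unlift (zero ∷ w)  = vecOf n w
  unlift (suc _ ∷ w) = vecOf n (preds w)

  ≢X : ∀ {y} → InLink y → toList y ≢ X
  ≢X {y} (_ , y∉x , _) e = y∉x (here (toList-injective y x e))

  comparable : ∀ {y} → InLink y → Comparable X (toList y)
  comparable (_ , _ , (_ , c) ∷ []) = c

  lift-vtx : ∀ {y} → InLink y → Vtx (SpreadBoxᴳ q (0 ∷ X)) (lift y)
  lift-vtx {y} iy@((asc , bds) , _) with X ≼? toList y | comparable iy
  ... | yes X≼y | inj₁ (_ , y≼sX) =
    ascending-∷ (All.tabulate (λ _ → z≤n)) asc , z≤n ∷ X≼y , z≤n ∷ y≼sX , z≤n ∷ bds , (λ e → ≢X iy (∷-injectiveʳ e)) , λ ()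
  ... | yes X≼y | inj₂ (y≼X , _) =
    ascending-∷ (All.tabulate (λ _ → z≤n)) asc , z≤n ∷ X≼y , z≤n ∷ subst (_≼ sucs X) (sym (≼-antisym y≼X X≼y)) (≼-sucs X)
    , z≤n ∷ bds , (λ e → ≢X iy (∷-injectiveʳ e)) , λ ()
  ... | no X⋠y  | inj₁ (X≼y , _) = ⊥-elim (X⋠y X≼y)
  ... | no _    | inj₂ (y≼X , X≼sy) =
    ascending-∷ (sucs-positive (toList y)) (ascending-map s≤s asc) , z≤n ∷ X≼sy , ≤-refl ∷ sucs-mono y≼X
    , s≤s z≤n ∷ All-≤-sucs (toList y) bds , (λ ()) , (λ e → ≢X iy (sucs-injective (∷-injectiveʳ e)))

  length≡n : ∀ {w} → X ≼ w → length w ≡ n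
  length≡n X≼w = trans (sym (Pointwise-length X≼w)) (length-toList x)

  data View : List ℕ → Set where
    above : ∀ w → X ≼ w → w ≼ sucs X → View (0 ∷ w)
    below : ∀ w → X ≼ w → w ≼ sucs X → All (1 ≤_) w → View (1 ∷ w)

  view : ∀ {z} → Vtx (SpreadBoxᴳ q (0 ∷ X)) z → View z
  view {zero ∷ w}        (_   , _ ∷ X≼w , _ ∷ w≼sX , _) = above w X≼w w≼sX
  view {suc zero ∷ w}    (asc , _ ∷ X≼w , _ ∷ w≼sX , _) = below w X≼w w≼sX (ascending-head asc)
  view {suc (suc _) ∷ w} (_   , _ , s≤s () ∷ _ , _)

  preds-≼ : ∀ {w} → w ≼ sucs X → preds w ≼ X
  preds-≼ w≼sX = subst (_ ≼_) (preds-sucs X) (preds-mono w≼sX)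

  unlifted : ∀ {z} → View z → List ℕ
  unlifted (above w _ _)   = w
  unlifted (below w _ _ _) = preds w

  toList-unlift : ∀ {z} (vz : View z) → toList (unlift z) ≡ unlifted vz
  toList-unlift (above w X≼w _)   = toList-vecOf n w (length≡n X≼w)
  toList-unlift (below w X≼w _ _) = toList-vecOf n (preds w) (trans (length-map ℕ.pred w) (length≡n X≼w))

  unlift-vtx : ∀ {z} → Vtx (SpreadBoxᴳ q (0 ∷ X)) z → InLink (unlift z)
  unlift-vtx {z} vz@(asc , _ , _ , _ ∷ bds , z≢u , z≢su) with view vz | toList-unlift (view vz)
  ... | above w X≼w w≼sX | e =
    subst (λ l → Ascending l × All (_≤ q) l) (sym e) (ascending-tail asc , bds)
    , (λ { (here eq) → z≢u (cong (0 ∷_) (trans (sym e) (cong toList eq))) })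
    , subst (λ l → Comparable l X × Comparable X l) (sym e) (inj₂ (X≼w , w≼sX) , inj₁ (X≼w , w≼sX)) ∷ []
  ... | below w X≼w w≼sX w≥1 | e =
    subst (λ l → Ascending l × All (_≤ q) l) (sym e) (ascending-map pred-mono-≤ (ascending-tail asc) , All-≤-preds bds)
    , (λ { (here eq) → z≢su (cong (1 ∷_) (trans (sym (sucs-preds w≥1)) (cong sucs (trans (sym e) (cong toList eq))))) })
    , subst (λ l → Comparable l X × Comparable X l) (sym e) (inj₁ step , inj₂ step) ∷ []
    where
    step : Step (preds w) X
    step = preds-≼ w≼sX , subst (X ≼_) (sym (sucs-preds w≥1)) X≼w

  lift-adj : ∀ {y y′} → InLink y → InLink y′ → Comparable (toList y) (toList y′) → Adj (SpreadBoxᴳ q (0 ∷ X)) (lift y) (lift y′)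
  lift-adj {y} {y′} _ _ c with X ≼? toList y | X ≼? toList y′ | c
  ... | yes _ | yes _ | inj₁ (y≼y′ , _)  = inj₁ (z≤n ∷ y≼y′)
  ... | yes _ | yes _ | inj₂ (y′≼y , _)  = inj₂ (z≤n ∷ y′≼y)
  ... | yes _ | no _  | inj₁ (y≼y′ , _)  = inj₁ (z≤n ∷ ≼-trans y≼y′ (≼-sucs _))
  ... | yes _ | no _  | inj₂ (_ , y≼sy′) = inj₁ (z≤n ∷ y≼sy′)
  ... | no _  | yes _ | inj₁ (_ , y′≼sy) = inj₂ (z≤n ∷ y′≼sy)
  ... | no _  | yes _ | inj₂ (y′≼y , _)  = inj₂ (z≤n ∷ ≼-trans y′≼y (≼-sucs _))
  ... | no _  | no _  | inj₁ (y≼y′ , _)  = inj₁ (≤-refl ∷ sucs-mono y≼y′)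
  ... | no _  | no _  | inj₂ (y′≼y , _)  = inj₂ (≤-refl ∷ sucs-mono y′≼y)

  unlifted-adj : ∀ {z z′} (vz : View z) (vz′ : View z′) → z ≼ z′ ⊎ z′ ≼ z → Comparable (unlifted vz) (unlifted vz′)
  unlifted-adj (above w X≼w _) (above w′ _ w′≼sX) (inj₁ (_ ∷ w≼w′)) = inj₁ (w≼w′ , ≼-trans w′≼sX (sucs-mono X≼w))
  unlifted-adj (above w _ w≼sX) (above w′ X≼w′ _) (inj₂ (_ ∷ w′≼w)) = inj₂ (w′≼w , ≼-trans w≼sX (sucs-mono X≼w′))
  unlifted-adj (above w X≼w _) (below w′ _ w′≼sX w′≥1) (inj₁ (_ ∷ w≼w′)) =
    inj₂ (≼-trans (preds-≼ w′≼sX) X≼w , subst (w ≼_) (sym (sucs-preds w′≥1)) w≼w′)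
  unlifted-adj (above _ _ _) (below _ _ _ _) (inj₂ (() ∷ _))
  unlifted-adj (below _ _ _ _) (above _ _ _) (inj₁ (() ∷ _))
  unlifted-adj (below w _ w≼sX w≥1) (above w′ X≼w′ _) (inj₂ (_ ∷ w′≼w)) =
    inj₁ (≼-trans (preds-≼ w≼sX) X≼w′ , subst (w′ ≼_) (sym (sucs-preds w≥1)) w′≼w)
  unlifted-adj (below w X≼w _ w≥1) (below w′ _ w′≼sX _) (inj₁ (_ ∷ w≼w′)) =
    inj₁ (preds-mono w≼w′ , subst (_ ≼_) (sym (sucs-preds w≥1)) (≼-trans (preds-≼ w′≼sX) X≼w))
  unlifted-adj (below w _ w≼sX _) (below w′ X≼w′ _ w′≥1) (inj₂ (_ ∷ w′≼w)) =
    inj₂ (preds-mono w′≼w , subst (_ ≼_) (sym (sucs-preds w′≥1)) (≼-trans (preds-≼ w≼sX) X≼w′))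

  unlift-adj : ∀ {z z′} → Vtx (SpreadBoxᴳ q (0 ∷ X)) z → Vtx (SpreadBoxᴳ q (0 ∷ X)) z′ →
               z ≼ z′ ⊎ z′ ≼ z → Comparable (toList (unlift z)) (toList (unlift z′))
  unlift-adj vz vz′ c = subst₂ Comparable (sym (toList-unlift (view vz))) (sym (toList-unlift (view vz′)))
                          (unlifted-adj (view vz) (view vz′) c)

  unlift-lift : ∀ {y} → InLink y → unlift (lift y) ≡ y
  unlift-lift {y} _ with X ≼? toList y
  ... | yes _ = vecOf-toList y
  ... | no _  = trans (cong (vecOf n) (preds-sucs (toList y))) (vecOf-toList y)

  lift-unlift′ : ∀ {z} → Vtx (SpreadBoxᴳ q (0 ∷ X)) z → View z → lift (unlift z) ≡ z
  lift-unlift′ _ (above w X≼w _) with X ≼? toList (vecOf n w)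
  ... | yes _   = cong (0 ∷_) (toList-vecOf n w (length≡n X≼w))
  ... | no X⋠w = ⊥-elim (X⋠w (subst (X ≼_) (sym (toList-vecOf n w (length≡n X≼w))) X≼w))
  lift-unlift′ (_ , _ , _ , _ , _ , z≢su) vz@(below w X≼w w≼sX w≥1) with X ≼? toList (vecOf n (preds w))
  ... | yes X≼w′ = ⊥-elim (z≢su (cong (1 ∷_) (trans (sym (sucs-preds w≥1))
                     (cong sucs (≼-antisym (preds-≼ w≼sX) (subst (X ≼_) (toList-unlift vz) X≼w′))))))
  ... | no _     = cong (1 ∷_) (trans (cong sucs (toList-unlift vz)) (sucs-preds w≥1))

linkᴳ-Tᴳ≃SpreadBox : ∀ {n q} (x : Vec ℕ n) → Vtx (Tᴳ n q) x → linkᴳ (Tᴳ n q) [ x ] ≃ SpreadBoxᴳ q (0 ∷ toList x)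
linkᴳ-Tᴳ≃SpreadBox x vx = record
  { f = lift ; g = unlift ; f-vtx = lift-vtx ; g-vtx = unlift-vtx ; f-adj = lift-adj ; g-adj = unlift-adj
  ; gf = unlift-lift ; fg = λ vz → lift-unlift′ vz (view vz) }
  where open VertexLinkᵀ x vx

take-length-++ : ∀ {A : Set} (xs ys : List A) → take (length xs) (xs ++ ys) ≡ xs
take-length-++ []       ys = refl
take-length-++ (x ∷ xs) ys = cong (x ∷_) (take-length-++ xs ys)

drop-length-++ : ∀ {A : Set} (xs ys : List A) → drop (length xs) (xs ++ ys) ≡ ys
drop-length-++ []       ys = refl
drop-length-++ (x ∷ xs) ys = drop-length-++ xs ys

++-cancel-length : ∀ {A : Set} {a b c d : List A} → length a ≡ length c → a ++ b ≡ c ++ d → a ≡ c × b ≡ d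
++-cancel-length {a = []}    {c = []}    _ e = refl , e
++-cancel-length {a = x ∷ a} {c = y ∷ c} l e with ++-cancel-length {a = a} {c = c} (suc-injective l) (∷-injectiveʳ e)
... | a≡c , b≡d = cong₂ _∷_ (∷-injectiveˡ e) a≡c , b≡d

module _ {R : ℕ → ℕ → Set} where

  Pointwise-++ˡ⁻ : ∀ xs {ys z} → Pointwise R (xs ++ ys) z →
                   ∃ λ z₁ → ∃ λ z₂ → z ≡ z₁ ++ z₂ × Pointwise R xs z₁ × Pointwise R ys z₂
  Pointwise-++ˡ⁻ []       rs       = [] , _ , refl , [] , rs
  Pointwise-++ˡ⁻ (x ∷ xs) (r ∷ rs) with Pointwise-++ˡ⁻ xs rs
  ... | z₁ , z₂ , refl , rs₁ , rs₂ = _ ∷ z₁ , z₂ , refl , r ∷ rs₁ , rs₂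

  Pointwise-++⁻ : ∀ {a b c d} → length a ≡ length c → Pointwise R (a ++ b) (c ++ d) → Pointwise R a c × Pointwise R b d
  Pointwise-++⁻ {[]}    {c = []}    _ rs       = [] , rs
  Pointwise-++⁻ {_ ∷ a} {c = _ ∷ c} e (r ∷ rs) = Product.map₁ (r ∷_) (Pointwise-++⁻ {a} {c = c} (suc-injective e) rs)

  Pointwise-take : ∀ m {z z′} → Pointwise R z z′ → Pointwise R (take m z) (take m z′)
  Pointwise-take zero    _        = []
  Pointwise-take (suc m) []       = []
  Pointwise-take (suc m) (r ∷ rs) = r ∷ Pointwise-take m rs

  Pointwise-drop : ∀ m {z z′} → Pointwise R z z′ → Pointwise R (drop m z) (drop m z′)
  Pointwise-drop zero    rs       = rs
  Pointwise-drop (suc m) []       = []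
  Pointwise-drop (suc m) (r ∷ rs) = Pointwise-drop m rs

  replicate-Pointwiseˡ⁺ : ∀ {c l} → All (R c) l → Pointwise R (replicate (length l) c) l
  replicate-Pointwiseˡ⁺ []       = []
  replicate-Pointwiseˡ⁺ (p ∷ ps) = p ∷ replicate-Pointwiseˡ⁺ ps

  replicate-Pointwiseʳ⁺ : ∀ {c l} → All (λ e → R e c) l → Pointwise R l (replicate (length l) c)
  replicate-Pointwiseʳ⁺ []       = []
  replicate-Pointwiseʳ⁺ (p ∷ ps) = p ∷ replicate-Pointwiseʳ⁺ ps

  replicate-Pointwiseˡ⁻ : ∀ {c a l} → Pointwise R (replicate a c) l → All (R c) l
  replicate-Pointwiseˡ⁻ {a = zero}  []       = []
  replicate-Pointwiseˡ⁻ {a = suc a} (r ∷ rs) = r ∷ replicate-Pointwiseˡ⁻ rs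

  replicate-Pointwiseʳ⁻ : ∀ {c a l} → Pointwise R l (replicate a c) → All (λ e → R e c) l
  replicate-Pointwiseʳ⁻ {a = zero}  []       = []
  replicate-Pointwiseʳ⁻ {a = suc a} (r ∷ rs) = r ∷ replicate-Pointwiseʳ⁻ rs

ascending-++ : ∀ {xs ys} → Ascending xs → Ascending ys → All (λ e → All (e ≤_) ys) xs → Ascending (xs ++ ys)
ascending-++ {[]}             _        asc _                = asc
ascending-++ {x ∷ []} {[]}    _        _   _                = [-]
ascending-++ {x ∷ []} {y ∷ ys} _       asc ((x≤y ∷ _) ∷ []) = x≤y ∷ asc
ascending-++ {x ∷ x′ ∷ xs} (r ∷ rs) asc (_ ∷ bds)          = r ∷ ascending-++ rs asc bds

ascending-++ˡ : ∀ xs {ys} → Ascending (xs ++ ys) → Ascending xs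
ascending-++ˡ []            _        = []
ascending-++ˡ (x ∷ [])      _        = [-]
ascending-++ˡ (x ∷ x′ ∷ xs) (r ∷ rs) = r ∷ ascending-++ˡ (x′ ∷ xs) rs

ascending-++ʳ : ∀ xs {ys} → Ascending (xs ++ ys) → Ascending ys
ascending-++ʳ []       asc = asc
ascending-++ʳ (x ∷ xs) asc = ascending-++ʳ xs (ascending-tail asc)

ascending-++-bound : ∀ xs {y ys} → Ascending (xs ++ y ∷ ys) → All (_≤ y) xs
ascending-++-bound []       _   = []
ascending-++-bound (x ∷ xs) asc = All.lookup (ascending-head asc) (∈-++⁺ʳ xs (here refl)) ∷ ascending-++-bound xs (ascending-tail asc)

+q-∸q : ∀ q {l} → All (q ≤_) l → map (_+ q) (map (_∸ q) l) ≡ l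
+q-∸q q []       = refl
+q-∸q q (p ∷ ps) = cong₂ _∷_ (m∸n+n≡m p) (+q-∸q q ps)

∸q-+q : ∀ q l → map (_∸ q) (map (_+ q) l) ≡ l
∸q-+q q []      = refl
∸q-+q q (e ∷ l) = cong₂ _∷_ (m+n∸n≡m e q) (∸q-+q q l)

first-≤-all : ∀ {z} → Ascending z → All (first z ≤_) z
first-≤-all {[]}    _   = []
first-≤-all {x ∷ z} asc = ≤-refl ∷ ascending-head asc

-- Write the lower corner u of the spread box as A ++ q^a with A = 0 ∷ X₁ below q.  Moving the last a entries to the
-- front and subtracting q from them turns the spread bound z ≤ first z + q into monotonicity across the seam.
module Rotation (q : ℕ) (X₁ : List ℕ) (a : ℕ) (A<q : All (λ e → suc e ≤ q) (0 ∷ X₁)) where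

  A B u û : List ℕ
  A = 0 ∷ X₁
  B = replicate a q
  u = A ++ B
  û = replicate a 0 ++ A

  rotate : List ℕ → List ℕ
  rotate z = map (_∸ q) (drop (length A) z) ++ take (length A) z

  unrotate : List ℕ → List ℕ
  unrotate w = drop a w ++ map (_+ q) (take a w)

  record SpreadSplit (z : List ℕ) : Set where
    field
      zA zB   : List ℕ
      z≡      : z ≡ zA ++ zB
      A≼zA    : A ≼ zA
      B≼zB    : B ≼ zB
      zA≼sucs : zA ≼ sucs A
      zB≼sucs : zB ≼ sucs B

  spreadSplit : ∀ {z} → u ≼ z → z ≼ sucs u → SpreadSplit z
  spreadSplit {z} u≼z z≼su with Pointwise-++ˡ⁻ A u≼z
  ... | zA , zB , refl , A≼zA , B≼zB = record
    { zA = zA ; zB = zB ; z≡ = refl ; A≼zA = A≼zA ; B≼zB = B≼zB ; zA≼sucs = proj₁ upper ; zB≼sucs = proj₂ upper }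
    where
    upper : zA ≼ sucs A × zB ≼ sucs B
    upper = Pointwise-++⁻ {a = zA} {c = sucs A} (trans (sym (Pointwise-length A≼zA)) (sym (length-map suc A)))
                          (subst ((zA ++ zB) ≼_) (map-++ suc A B) z≼su)

  record BoxSplit (w : List ℕ) : Set where
    field
      wB wA   : List ℕ
      w≡      : w ≡ wB ++ wA
      0≼wB    : replicate a 0 ≼ wB
      A≼wA    : A ≼ wA
      wB≼1    : wB ≼ replicate a 1
      wA≼sucs : wA ≼ sucs A

  boxSplit : ∀ {w} → û ≼ w → w ≼ sucs û → BoxSplit w
  boxSplit {w} û≼w w≼sû with Pointwise-++ˡ⁻ (replicate a 0) û≼w
  ... | wB , wA , refl , 0≼wB , A≼wA = record
    { wB = wB ; wA = wA ; w≡ = refl ; 0≼wB = 0≼wB ; A≼wA = A≼wA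
    ; wB≼1 = subst (wB ≼_) (map-replicate suc a 0) (proj₁ upper) ; wA≼sucs = proj₂ upper }
    where
    upper : wB ≼ sucs (replicate a 0) × wA ≼ sucs A
    upper = Pointwise-++⁻ {a = wB} {c = sucs (replicate a 0)}
              (trans (sym (Pointwise-length 0≼wB)) (sym (length-map suc (replicate a 0))))
              (subst ((wB ++ wA) ≼_) (map-++ suc (replicate a 0) A) w≼sû)

  length-zA : ∀ {zA} → A ≼ zA → length zA ≡ length A
  length-zA r = sym (Pointwise-length r)

  length-zB : ∀ {zB} → B ≼ zB → length zB ≡ a
  length-zB r = trans (sym (Pointwise-length r)) (length-replicate a)

  length-wB : ∀ {wB} → replicate a 0 ≼ wB → length wB ≡ a
  length-wB r = trans (sym (Pointwise-length r)) (length-replicate a)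

  rotate-++ : ∀ zA zB → length zA ≡ length A → rotate (zA ++ zB) ≡ map (_∸ q) zB ++ zA
  rotate-++ zA zB e = subst (λ m → map (_∸ q) (drop m (zA ++ zB)) ++ take m (zA ++ zB) ≡ map (_∸ q) zB ++ zA) e
                        (cong₂ _++_ (cong (map (_∸ q)) (drop-length-++ zA zB)) (take-length-++ zA zB))

  unrotate-++ : ∀ wB wA → length wB ≡ a → unrotate (wB ++ wA) ≡ wA ++ map (_+ q) wB
  unrotate-++ wB wA e = subst (λ m → drop m (wB ++ wA) ++ map (_+ q) (take m (wB ++ wA)) ≡ wA ++ map (_+ q) wB) e
                          (cong₂ _++_ (drop-length-++ wB wA) (cong (map (_+ q)) (take-length-++ wB wA)))

  first-++ : ∀ {zA} zB → A ≼ zA → first (zA ++ zB) ≡ first zA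
  first-++ zB (_ ∷ _) = refl

  below-sucsA⇒≤q : ∀ {wA} → wA ≼ sucs A → All (_≤ q) wA
  below-sucsA⇒≤q r = go r A<q
    where
    go : ∀ {l A′} → l ≼ sucs A′ → All (λ e → suc e ≤ q) A′ → All (_≤ q) l
    go {A′ = []}    []       []       = []
    go {A′ = _ ∷ _} (r ∷ rs) (p ∷ ps) = ≤-trans r p ∷ go rs ps

  ≤-first : ∀ wB {wA} → A ≼ wA → Ascending (wB ++ wA) → All (_≤ first wA) wB
  ≤-first wB (_ ∷ _) asc = ascending-++-bound wB asc

  length-map≡a : ∀ {f : ℕ → ℕ} {l} → length l ≡ a → length (map f l) ≡ length (replicate a 0)
  length-map≡a {f} {l} e = trans (length-map f l) (trans e (sym (length-replicate a)))

  rotate-vtx : ∀ {z} → Vtx (SpreadBoxᴳ q u) z → Vtx (Boxᴳ û) (rotate z)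
  rotate-vtx (asc , u≼z , z≼su , spread , z≢u , z≢su) with spreadSplit u≼z z≼su
  ... | record { zA = zA ; zB = zB ; z≡ = refl ; A≼zA = A≼zA ; B≼zB = B≼zB ; zA≼sucs = zA≼sucs ; zB≼sucs = zB≼sucs } =
    subst (Vtx (Boxᴳ û)) (sym (rotate-++ zA zB (length-zA A≼zA)))
      ( ascending-++ (ascending-map (∸-monoˡ-≤ q) (ascending-++ʳ zA asc)) (ascending-++ˡ zA asc) seam
      , Pointwise.++⁺ (subst (λ l → Pointwise _≤_ l (map (_∸ q) zB)) (cong (λ m → replicate m 0) |zB|)
                        (replicate-Pointwiseˡ⁺ (All.tabulate (λ _ → z≤n)))) A≼zA
      , subst ((map (_∸ q) zB ++ zA) ≼_) (sym (map-++ suc (replicate a 0) A))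
          (Pointwise.++⁺ (subst (map (_∸ q) zB ≼_) (trans (cong (λ m → replicate m 1) |zB|) (sym (map-replicate suc a 0)))
                           (replicate-Pointwiseʳ⁺ (≤1 (replicate-Pointwiseʳ⁻ (subst (zB ≼_) (map-replicate suc a q) zB≼sucs)))))
                         zA≼sucs)
      , ≢û , ≢sû )
    where
    |zB| : length (map (_∸ q) zB) ≡ a
    |zB| = trans (length-map _ zB) (length-zB B≼zB)
    ≤1 : ∀ {l} → All (_≤ suc q) l → All (_≤ 1) (map (_∸ q) l)
    ≤1 []                = []
    ≤1 {e ∷ l} (p ∷ ps) = subst (e ∸ q ≤_) (m+n∸n≡m 1 q) (∸-monoˡ-≤ q p) ∷ ≤1 ps
    seam : All (λ e → All (e ≤_) zA) (map (_∸ q) zB)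
    seam = Allₚ.map⁺ (All.map (λ e≤ → All.map (≤-trans (subst (_ ∸ q ≤_) (m+n∸n≡m _ q) (∸-monoˡ-≤ q e≤)))
                                                (first-≤-all (ascending-++ˡ zA asc)))
                             (subst (λ h → All (_≤ h + q) zB) (first-++ zB A≼zA) (Allₚ.++⁻ʳ zA spread)))
    zB≡ : map (_+ q) (map (_∸ q) zB) ≡ zB
    zB≡ = +q-∸q q (replicate-Pointwiseˡ⁻ B≼zB)
    ≢û : map (_∸ q) zB ++ zA ≢ û
    ≢û e with ++-cancel-length (length-map≡a {_∸ q} {zB} (length-zB B≼zB)) e
    ... | e₁ , e₂ = z≢u (cong₂ _++_ e₂ (trans (sym zB≡) (trans (cong (map (_+ q)) e₁) (map-replicate _ a 0))))
    ≢sû : map (_∸ q) zB ++ zA ≢ sucs û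
    ≢sû e with ++-cancel-length (trans (length-map≡a {_∸ q} {zB} (length-zB B≼zB)) (sym (length-map suc (replicate a 0))))
                                 (trans e (map-++ suc (replicate a 0) A))
    ... | e₁ , e₂ = z≢su (trans (cong₂ _++_ e₂ (trans (sym zB≡) (trans (cong (map (_+ q)) (trans e₁ (map-replicate suc a 0)))
                                  (trans (map-replicate _ a 1) (sym (map-replicate suc a q))))))
                                (sym (map-++ suc A B)))

  unrotate-vtx : ∀ {w} → Vtx (Boxᴳ û) w → Vtx (SpreadBoxᴳ q u) (unrotate w)
  unrotate-vtx (asc , û≼w , w≼sû , w≢û , w≢sû) with boxSplit û≼w w≼sû
  ... | record { wB = wB ; wA = wA ; w≡ = refl ; 0≼wB = 0≼wB ; A≼wA = A≼wA ; wB≼1 = wB≼1 ; wA≼sucs = wA≼sucs } =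
    subst (Vtx (SpreadBoxᴳ q u)) (sym (unrotate-++ wB wA |wB|))
      ( ascending-++ (ascending-++ʳ wB asc) (ascending-map (+-monoˡ-≤ q) (ascending-++ˡ wB asc)) seam
      , Pointwise.++⁺ A≼wA (subst (λ l → Pointwise _≤_ l (map (_+ q) wB)) (cong (λ m → replicate m q) |wB+q|)
                              (replicate-Pointwiseˡ⁺ (Allₚ.map⁺ (All.tabulate (λ {x} _ → m≤n+m q x)))))
      , subst ((wA ++ map (_+ q) wB) ≼_) (sym (map-++ suc A B))
          (Pointwise.++⁺ wA≼sucs (subst (map (_+ q) wB ≼_) (trans (cong (λ m → replicate m (suc q)) |wB+q|) (sym (map-replicate suc a q)))
                                   (replicate-Pointwiseʳ⁺ (Allₚ.map⁺ (All.map (+-monoˡ-≤ q) (replicate-Pointwiseʳ⁻ wB≼1))))))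
      , subst (λ h → All (_≤ h + q) (wA ++ map (_+ q) wB)) (sym (first-++ (map (_+ q) wB) A≼wA)) spread
      , ≢u , ≢su )
    where
    |wB| : length wB ≡ a
    |wB| = length-wB 0≼wB
    |wB+q| : length (map (_+ q) wB) ≡ a
    |wB+q| = trans (length-map _ wB) |wB|
    wA≤q : All (_≤ q) wA
    wA≤q = below-sucsA⇒≤q wA≼sucs
    seam : All (λ e → All (e ≤_) (map (_+ q) wB)) wA
    seam = All.map (λ e≤q → Allₚ.map⁺ (All.tabulate (λ {x} _ → ≤-trans e≤q (m≤n+m q x)))) wA≤q
    wB≤first : All (_≤ first wA) wB
    wB≤first = ≤-first wB A≼wA asc
    spread : All (_≤ first wA + q) (wA ++ map (_+ q) wB)
    spread = Allₚ.++⁺ (All.map (λ e≤q → ≤-trans e≤q (m≤n+m q _)) wA≤q) (Allₚ.map⁺ (All.map (+-monoˡ-≤ q) wB≤first))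
    ≢u : wA ++ map (_+ q) wB ≢ u
    ≢u e with ++-cancel-length (length-zA A≼wA) e
    ... | e₁ , e₂ = w≢û (cong₂ _++_ (trans (sym (∸q-+q q wB)) (trans (cong (map (_∸ q)) e₂)
                                    (trans (map-replicate _ a q) (cong (replicate a) (n∸n≡0 q))))) e₁)
    ≢su : wA ++ map (_+ q) wB ≢ sucs u
    ≢su e with ++-cancel-length (trans (length-zA A≼wA) (sym (length-map suc A))) (trans e (map-++ suc A B))
    ... | e₁ , e₂ = w≢sû (trans (cong₂ _++_ (trans (sym (∸q-+q q wB)) (trans (cong (map (_∸ q)) (trans e₂ (map-replicate suc a q)))
                                  (trans (map-replicate _ a (suc q)) (trans (cong (replicate a) (m+n∸n≡m 1 q))
                                    (sym (map-replicate suc a 0)))))) e₁)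
                                (sym (map-++ suc (replicate a 0) A)))

  rotate-mono : ∀ {z z′} → Vtx (SpreadBoxᴳ q u) z → Vtx (SpreadBoxᴳ q u) z′ → z ≼ z′ → rotate z ≼ rotate z′
  rotate-mono (_ , u≼z , z≼su , _) (_ , u≼z′ , z′≼su , _) r with spreadSplit u≼z z≼su | spreadSplit u≼z′ z′≼su
  ... | record { zA = zA ; zB = zB ; z≡ = refl ; A≼zA = A≼zA } | record { zA = zA′ ; zB = zB′ ; z≡ = refl ; A≼zA = A≼zA′ } =
    subst₂ _≼_ (sym (rotate-++ zA zB (length-zA A≼zA))) (sym (rotate-++ zA′ zB′ (length-zA A≼zA′)))
      (Pointwise.++⁺ (Pointwise.map⁺ _ _ (Pointwise.map (∸-monoˡ-≤ q) (proj₂ parts))) (proj₁ parts))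
    where
    parts : zA ≼ zA′ × zB ≼ zB′
    parts = Pointwise-++⁻ {a = zA} {c = zA′} (trans (length-zA A≼zA) (sym (length-zA A≼zA′))) r

  unrotate-mono : ∀ {w w′} → Vtx (Boxᴳ û) w → Vtx (Boxᴳ û) w′ → w ≼ w′ → unrotate w ≼ unrotate w′
  unrotate-mono (_ , û≼w , w≼sû , _) (_ , û≼w′ , w′≼sû , _) r with boxSplit û≼w w≼sû | boxSplit û≼w′ w′≼sû
  ... | record { wB = wB ; wA = wA ; w≡ = refl ; 0≼wB = 0≼wB } | record { wB = wB′ ; wA = wA′ ; w≡ = refl ; 0≼wB = 0≼wB′ } =
    subst₂ _≼_ (sym (unrotate-++ wB wA (length-wB 0≼wB))) (sym (unrotate-++ wB′ wA′ (length-wB 0≼wB′)))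
      (Pointwise.++⁺ (proj₂ parts) (Pointwise.map⁺ _ _ (Pointwise.map (+-monoˡ-≤ q) (proj₁ parts))))
    where
    parts : wB ≼ wB′ × wA ≼ wA′
    parts = Pointwise-++⁻ {a = wB} {c = wB′} (trans (length-wB 0≼wB) (sym (length-wB 0≼wB′))) r

  unrotate-rotate : ∀ {z} → Vtx (SpreadBoxᴳ q u) z → unrotate (rotate z) ≡ z
  unrotate-rotate (_ , u≼z , z≼su , _) with spreadSplit u≼z z≼su
  ... | record { zA = zA ; zB = zB ; z≡ = refl ; A≼zA = A≼zA ; B≼zB = B≼zB } = begin
    unrotate (rotate (zA ++ zB))                   ≡⟨ cong unrotate (rotate-++ zA zB (length-zA A≼zA)) ⟩
    unrotate (map (_∸ q) zB ++ zA)                 ≡⟨ unrotate-++ (map (_∸ q) zB) zA (trans (length-map _ zB) (length-zB B≼zB)) ⟩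
    zA ++ map (_+ q) (map (_∸ q) zB)               ≡⟨ cong (zA ++_) (+q-∸q q (replicate-Pointwiseˡ⁻ B≼zB)) ⟩
    zA ++ zB                                       ∎
    where open ≡-Reasoning

  rotate-unrotate : ∀ {w} → Vtx (Boxᴳ û) w → rotate (unrotate w) ≡ w
  rotate-unrotate (_ , û≼w , w≼sû , _) with boxSplit û≼w w≼sû
  ... | record { wB = wB ; wA = wA ; w≡ = refl ; 0≼wB = 0≼wB ; A≼wA = A≼wA } = begin
    rotate (unrotate (wB ++ wA))                   ≡⟨ cong rotate (unrotate-++ wB wA (length-wB 0≼wB)) ⟩
    rotate (wA ++ map (_+ q) wB)                   ≡⟨ rotate-++ wA (map (_+ q) wB) (length-zA A≼wA) ⟩
    map (_∸ q) (map (_+ q) wB) ++ wA               ≡⟨ cong (_++ wA) (∸q-+q q wB) ⟩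
    wB ++ wA                                       ∎
    where open ≡-Reasoning

SpreadBox≃Box : ∀ q X₁ a → All (λ e → suc e ≤ q) (0 ∷ X₁) →
                SpreadBoxᴳ q ((0 ∷ X₁) ++ replicate a q) ≃ Boxᴳ (replicate a 0 ++ 0 ∷ X₁)
SpreadBox≃Box q X₁ a A<q = record
  { f = rotate ; g = unrotate ; f-vtx = rotate-vtx ; g-vtx = unrotate-vtx
  ; f-adj = λ vz vz′ → Sum.map (rotate-mono vz vz′) (rotate-mono vz′ vz)
  ; g-adj = λ vw vw′ → Sum.map (unrotate-mono vw vw′) (unrotate-mono vw′ vw)
  ; gf = unrotate-rotate ; fg = rotate-unrotate }
  where open Rotation q X₁ a A<q

staircase : ℕ → List ℕ → List ℕ
staircase v []       = []
staircase v (m ∷ ms) = replicate m v ++ staircase (suc v) ms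

length-staircase : ∀ v ms → length (staircase v ms) ≡ sum ms
length-staircase v []       = refl
length-staircase v (m ∷ ms) = trans (length-++ (replicate m v)) (cong₂ _+_ (length-replicate m) (length-staircase (suc v) ms))

bump : ℕ → ℕ → ℕ → ℕ
bump v a c = if ⌊ a ≤? c ⌋ then suc v else v

bump-yes : ∀ v {a c} → a ≤ c → bump v a c ≡ suc v
bump-yes v {a} {c} a≤c with a ≤? c
... | yes _   = refl
... | no a≰c = ⊥-elim (a≰c a≤c)

bump-no : ∀ v {a c} → ¬ a ≤ c → bump v a c ≡ v
bump-no v {a} {c} a≰c with a ≤? c
... | yes a≤c = ⊥-elim (a≰c a≤c)
... | no _    = refl

block : ℕ → ℕ → ℕ → List ℕ
block v zero    c = []
block v (suc m) c = bump v (suc m) c ∷ block v m c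

length-block : ∀ v m c → length (block v m c) ≡ m
length-block v zero    c = refl
length-block v (suc m) c = cong suc (length-block v m c)

block-full : ∀ v m c → m ≤ c → block v m c ≡ replicate m (suc v)
block-full v zero    c _   = refl
block-full v (suc m) c m≤c = cong₂ _∷_ (bump-yes v m≤c) (block-full v m c (≤-trans (n≤1+n m) m≤c))

block-zero : ∀ v m → block v m 0 ≡ replicate m v
block-zero v zero    = refl
block-zero v (suc m) = cong₂ _∷_ (bump-no v {suc m} {0} (λ ())) (block-zero v m)

block-mono : ∀ v m {c c′} → c ≤ c′ → block v m c ≼ block v m c′
block-mono v zero    _    = []
block-mono v (suc m) {c} {c′} c≤c′ with suc m ≤? c | suc m ≤? c′
... | yes _   | yes _    = ≤-refl ∷ block-mono v m c≤c′
... | yes m≤c | no m≰c′ = ⊥-elim (m≰c′ (≤-trans m≤c c≤c′))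
... | no _    | yes _    = n≤1+n v ∷ block-mono v m c≤c′
... | no _    | no _     = ≤-refl ∷ block-mono v m c≤c′

block-bounds : ∀ v m c → All (λ e → v ≤ e × e ≤ suc v) (block v m c)
block-bounds v zero    c = []
block-bounds v (suc m) c with suc m ≤? c
... | yes _ = (n≤1+n v , ≤-refl) ∷ block-bounds v m c
... | no _  = (≤-refl , n≤1+n v) ∷ block-bounds v m c

block-ascending : ∀ v m c → Ascending (block v m c)
block-ascending v zero    c = []
block-ascending v (suc m) c = ascending-∷ head≤ (block-ascending v m c)
  where
  head≤ : All (bump v (suc m) c ≤_) (block v m c)
  head≤ with suc m ≤? c
  ... | yes m<c = subst (All (suc v ≤_)) (sym (block-full v m c (≤-trans (n≤1+n m) m<c))) (Allₚ.replicate⁺ m ≤-refl)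
  ... | no _    = All.map proj₁ (block-bounds v m c)

excess : ℕ → List ℕ → ℕ
excess v l = sum (map (_∸ v) l)

excess-replicate-suc : ∀ v k → excess v (replicate k (suc v)) ≡ k
excess-replicate-suc v zero    = refl
excess-replicate-suc v (suc k) = cong₂ _+_ (m+n∸n≡m 1 v) (excess-replicate-suc v k)

excess-block : ∀ v m c → c ≤ m → excess v (block v m c) ≡ c
excess-block v zero    zero _   = refl
excess-block v (suc m) c c≤m with suc m ≤? c
... | yes m<c = trans (cong₂ _+_ (m+n∸n≡m 1 v) (trans (cong (excess v) (block-full v m c (≤-trans (n≤1+n m) m<c)))
                                                      (excess-replicate-suc v m)))
                      (≤-antisym m<c c≤m)
... | no m≮c  = trans (cong (_+ excess v (block v m c)) (n∸n≡0 v)) (excess-block v m c (≤-pred (≰⇒> m≮c)))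

excess-mono : ∀ v {z z′} → z ≼ z′ → excess v z ≤ excess v z′
excess-mono v []       = z≤n
excess-mono v (r ∷ rs) = +-mono-≤ (∸-monoˡ-≤ v r) (excess-mono v rs)

all-≡⇒replicate : ∀ {c : ℕ} {l} → All (c ≡_) l → l ≡ replicate (length l) c
all-≡⇒replicate []          = refl
all-≡⇒replicate (refl ∷ ps) = cong (_ ∷_) (all-≡⇒replicate ps)

block-of : ∀ v z → Ascending z → All (λ e → v ≤ e × e ≤ suc v) z →
           excess v z ≤ length z × z ≡ block v (length z) (excess v z)
block-of v []      _   _                   = z≤n , refl
block-of v (e ∷ z) asc ((v≤e , e≤sv) ∷ bds) with m≤n⇒m<n∨m≡n e≤sv
... | inj₂ refl = ≤-reflexive full-excess
                , cong₂ _∷_ (sym (bump-yes v (≤-reflexive (sym full-excess))))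
                    (trans all-suc (sym (block-full v (length z) _ (≤-trans (n≤1+n _) (≤-reflexive (sym full-excess))))))
  where
  all-suc : z ≡ replicate (length z) (suc v)
  all-suc = all-≡⇒replicate (All.map (λ (sv≤x , _ , x≤sv) → ≤-antisym sv≤x x≤sv) (All.zip (ascending-head asc , bds)))
  full-excess : excess v (suc v ∷ z) ≡ suc (length z)
  full-excess = cong₂ _+_ (m+n∸n≡m 1 v) (trans (cong (excess v) all-suc) (excess-replicate-suc v (length z)))
... | inj₁ e<sv with ≤-antisym v≤e (≤-pred e<sv)
... | refl with block-of v z (ascending-tail asc) bds
... | excess≤ , z≡ = subst (_≤ suc (length z)) (sym excess-v∷z) (≤-trans excess≤ (n≤1+n _))
                   , cong₂ _∷_ (sym (bump-no v (λ full → 1+n≰n (≤-trans full (subst (_≤ length z) (sym excess-v∷z) excess≤)))))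
                               (trans z≡ (cong (block v (length z)) (sym excess-v∷z)))
  where
  excess-v∷z : excess v (v ∷ z) ≡ excess v z
  excess-v∷z = cong (_+ excess v z) (n∸n≡0 v)

-- c ≼ ms is encoded by raising the last c_i entries of the i-th step of the staircase.
encode : ℕ → List ℕ → List ℕ → List ℕ
encode v []       _        = []
encode v (m ∷ ms) []       = block v m 0 ++ encode (suc v) ms []
encode v (m ∷ ms) (c ∷ cs) = block v m c ++ encode (suc v) ms cs

decode : ℕ → List ℕ → List ℕ → List ℕ
decode v []       z = []
decode v (m ∷ ms) z = excess v (take m z) ∷ decode (suc v) ms (drop m z)

encode-zeros : ∀ v ms → encode v ms (zeros (length ms)) ≡ staircase v ms
encode-zeros v []       = refl
encode-zeros v (m ∷ ms) = cong₂ _++_ (block-zero v m) (encode-zeros (suc v) ms)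

encode-top : ∀ v ms → encode v ms ms ≡ sucs (staircase v ms)
encode-top v []       = refl
encode-top v (m ∷ ms) = trans (cong₂ _++_ (trans (block-full v m m ≤-refl) (sym (map-replicate suc m v))) (encode-top (suc v) ms))
                              (sym (map-++ suc (replicate m v) (staircase (suc v) ms)))

encode-mono : ∀ v {ms c c′} → c ≼ ms → c′ ≼ ms → c ≼ c′ → encode v ms c ≼ encode v ms c′
encode-mono v []                  []       []       = []
encode-mono v {m ∷ ms} (_ ∷ c≼) (_ ∷ c′≼) (r ∷ rs) = Pointwise.++⁺ (block-mono v m r) (encode-mono (suc v) c≼ c′≼ rs)

encode-≥ : ∀ v {ms c} → c ≼ ms → All (v ≤_) (encode v ms c)
encode-≥ v []                          = []
encode-≥ v {m ∷ ms} {c ∷ cs} (_ ∷ c≼) =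
  Allₚ.++⁺ (All.map proj₁ (block-bounds v m c)) (All.map (≤-trans (n≤1+n v)) (encode-≥ (suc v) c≼))

encode-ascending : ∀ v {ms c} → c ≼ ms → Ascending (encode v ms c)
encode-ascending v []                          = []
encode-ascending v {m ∷ ms} {c ∷ cs} (_ ∷ c≼) = ascending-++ (block-ascending v m c) (encode-ascending (suc v) c≼)
  (All.map (λ (_ , e≤sv) → All.map (≤-trans e≤sv) (encode-≥ (suc v) c≼)) (block-bounds v m c))

encode-inBox : ∀ v {ms c} → c ≼ ms → staircase v ms ≼ encode v ms c × encode v ms c ≼ sucs (staircase v ms)
encode-inBox v {ms} {c} c≼ = subst (_≼ encode v ms c) (encode-zeros v ms) (encode-mono v (zeros≼ ms) c≼ (zeros≼c c≼))
                          , subst (encode v ms c ≼_) (encode-top v ms) (encode-mono v c≼ ≼-refl c≼)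
  where
  zeros≼c : ∀ {c ms} → c ≼ ms → zeros (length ms) ≼ c
  zeros≼c []       = []
  zeros≼c (_ ∷ rs) = z≤n ∷ zeros≼c rs

decode-encode : ∀ v {ms c} → c ≼ ms → decode v ms (encode v ms c) ≡ c
decode-encode v []                          = refl
decode-encode v {m ∷ ms} {c ∷ cs} (c≤m ∷ c≼) = cong₂ _∷_
  (trans (cong (λ k → excess v (take k (block v m c ++ rest))) (sym (length-block v m c)))
         (trans (cong (excess v) (take-length-++ (block v m c) rest)) (excess-block v m c c≤m)))
  (trans (cong (λ k → decode (suc v) ms (drop k (block v m c ++ rest))) (sym (length-block v m c)))
         (trans (cong (decode (suc v) ms) (drop-length-++ (block v m c) rest)) (decode-encode (suc v) c≼)))
  where
  rest : List ℕ
  rest = encode (suc v) ms cs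

decode-mono : ∀ v ms {z z′} → z ≼ z′ → decode v ms z ≼ decode v ms z′
decode-mono v []       r = []
decode-mono v (m ∷ ms) r = excess-mono v (Pointwise-take m r) ∷ decode-mono (suc v) ms (Pointwise-drop m r)

encode-decode : ∀ v ms {z} → Ascending z → staircase v ms ≼ z → z ≼ sucs (staircase v ms) →
                decode v ms z ≼ ms × encode v ms (decode v ms z) ≡ z
encode-decode v []       asc [] _ = [] , refl
encode-decode v (m ∷ ms) {z} asc lower upper with Pointwise-++ˡ⁻ (replicate m v) lower
... | z₁ , z₂ , refl , lower₁ , lower₂ =
  subst (_≤ m) (sym take≡) (proj₁ z₁-block) ∷ subst (_≼ ms) (sym drop≡) (proj₁ rest)
  , trans (cong₂ (λ a b → block v m a ++ encode (suc v) ms b) take≡ drop≡) (cong₂ _++_ (sym (proj₂ z₁-block)) (proj₂ rest))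
  where
  |z₁| : length z₁ ≡ m
  |z₁| = trans (sym (Pointwise-length lower₁)) (length-replicate m)
  uppers : z₁ ≼ sucs (replicate m v) × z₂ ≼ sucs (staircase (suc v) ms)
  uppers = Pointwise-++⁻ {a = z₁} {c = sucs (replicate m v)}
             (trans |z₁| (trans (sym (length-replicate m)) (sym (length-map suc (replicate m v)))))
             (subst ((z₁ ++ z₂) ≼_) (map-++ suc (replicate m v) (staircase (suc v) ms)) upper)
  z₁-bounds : All (λ e → v ≤ e × e ≤ suc v) z₁
  z₁-bounds = All.zip (replicate-Pointwiseˡ⁻ lower₁ , replicate-Pointwiseʳ⁻ (subst (z₁ ≼_) (map-replicate suc m v) (proj₁ uppers)))
  z₁-block : excess v z₁ ≤ m × z₁ ≡ block v m (excess v z₁)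
  z₁-block = Product.map (subst (excess v z₁ ≤_) |z₁|) (λ e → trans e (cong (λ k → block v k (excess v z₁)) |z₁|))
               (block-of v z₁ (ascending-++ˡ z₁ asc) z₁-bounds)
  rest : decode (suc v) ms z₂ ≼ ms × encode (suc v) ms (decode (suc v) ms z₂) ≡ z₂
  rest = encode-decode (suc v) ms (ascending-++ʳ z₁ asc) lower₂ (proj₂ uppers)
  take≡ : excess v (take m (z₁ ++ z₂)) ≡ excess v z₁
  take≡ = trans (cong (λ k → excess v (take k (z₁ ++ z₂))) (sym |z₁|)) (cong (excess v) (take-length-++ z₁ z₂))
  drop≡ : decode (suc v) ms (drop m (z₁ ++ z₂)) ≡ decode (suc v) ms z₂
  drop≡ = trans (cong (λ k → decode (suc v) ms (drop k (z₁ ++ z₂))) (sym |z₁|)) (cong (decode (suc v) ms) (drop-length-++ z₁ z₂))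

Kᴳ≃Box : ∀ ms → Kᴳ ms ≃ Boxᴳ (staircase 0 ms)
Kᴳ≃Box ms = record
  { f = encode 0 ms ; g = decode 0 ms
  ; f-vtx = λ (c≼ , c≢0 , c≢ms) → encode-ascending 0 c≼ , proj₁ (encode-inBox 0 c≼) , proj₂ (encode-inBox 0 c≼)
      , (λ e → c≢0 (trans (sym (decode-encode 0 c≼)) (trans (cong (decode 0 ms) (trans e (sym (encode-zeros 0 ms))))
                                                            (decode-encode 0 (zeros≼ ms)))))
      , (λ e → c≢ms (trans (sym (decode-encode 0 c≼)) (trans (cong (decode 0 ms) (trans e (sym (encode-top 0 ms))))
                                                             (decode-encode 0 ≼-refl))))
  ; g-vtx = λ (asc , lower , upper , z≢ , z≢s) → let (d≼ , ed≡z) = encode-decode 0 ms asc lower upper in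
      d≼ , (λ e → z≢ (trans (sym ed≡z) (trans (cong (encode 0 ms) e) (encode-zeros 0 ms))))
         , (λ e → z≢s (trans (sym ed≡z) (trans (cong (encode 0 ms) e) (encode-top 0 ms))))
  ; f-adj = λ (c≼ , _) (c′≼ , _) → Sum.map (encode-mono 0 c≼ c′≼) (encode-mono 0 c′≼ c≼)
  ; g-adj = λ _ _ → Sum.map (decode-mono 0 ms) (decode-mono 0 ms)
  ; gf = λ (c≼ , _) → decode-encode 0 c≼
  ; fg = λ (asc , lower , upper , _) → proj₂ (encode-decode 0 ms asc lower upper) }

ascending-replicate : ∀ k (c : ℕ) → Ascending (replicate k c)
ascending-replicate zero          c = []
ascending-replicate (suc zero)    c = [-]
ascending-replicate (suc (suc k)) c = ≤-refl ∷ ascending-replicate (suc k) c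

splitLeading : ∀ v w → Ascending w → All (v ≤_) w → ∃ λ k → ∃ λ w′ → w ≡ replicate k v ++ w′ × All (suc v ≤_) w′
splitLeading v []      _   _            = 0 , [] , refl , []
splitLeading v (a ∷ w) asc (v≤a ∷ v≤w) with a ℕ.≟ v
... | yes refl = let (k , w′ , w≡ , v<w′) = splitLeading v w (ascending-tail asc) v≤w in suc k , w′ , cong (v ∷_) w≡ , v<w′
... | no a≢v  = 0 , a ∷ w , refl , v<a ∷ All.map (≤-trans v<a) (ascending-head asc)
  where
  v<a : v < a
  v<a = ≤∧≢⇒< v≤a (λ e → a≢v (sym e))

staircase-of : ∀ v r w → Ascending w → All (v ≤_) w → All (_< v + r) w → ∃ λ ms → staircase v ms ≡ w
staircase-of v zero    []      _   _         _           = [] , refl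
staircase-of v zero    (a ∷ w) _   (v≤a ∷ _) (a<v+0 ∷ _) = ⊥-elim (<⇒≱ (subst (a <_) (+-identityʳ v) a<v+0) v≤a)
staircase-of v (suc r) w       asc v≤w       w<v+r with splitLeading v w asc v≤w
... | k , w′ , refl , v<w′ =
  let (ms , staircase≡) = staircase-of (suc v) r w′ (ascending-++ʳ (replicate k v) asc) v<w′
                            (subst (λ b → All (_< b) w′) (+-suc v r) (Allₚ.++⁻ʳ (replicate k v) w<v+r))
  in k ∷ ms , cong (replicate k v ++_) staircase≡

splitTop : ∀ q X → Ascending X → All (_≤ q) X → ∃ λ X₁ → ∃ λ a → X ≡ X₁ ++ replicate a q × All (_< q) X₁
splitTop q []      _   _            = [] , 0 , refl , []
splitTop q (e ∷ X) asc (e≤q ∷ X≤q) with e <? q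
... | yes e<q = let (X₁ , a , X≡ , X₁<q) = splitTop q X (ascending-tail asc) X≤q in e ∷ X₁ , a , cong (e ∷_) X≡ , e<q ∷ X₁<q
... | no e≮q  = [] , suc (length X) , all-≡⇒replicate (sym e≡q ∷ All.map (λ (e≤x , x≤q) → ≤-antisym (subst (_≤ _) e≡q e≤x) x≤q)
                                                                      (All.zip (ascending-head asc , X≤q))) , []
  where
  e≡q : e ≡ q
  e≡q = ≤-antisym e≤q (≮⇒≥ e≮q)

≃-reflexive : ∀ {G H} → G ≡ H → G ≃ H
≃-reflexive refl = ≃-refl

vertexLink-KJoin : ∀ {n q} → 1 ≤ q → (x : Vec ℕ n) → Vtx (Tᴳ n q) x → KJoin (linkᴳ (Tᴳ n q) [ x ]) 1 (suc n)
vertexLink-KJoin {n} {q} q≥1 x vx@(ascX , X≤q) = fromSplit (splitTop q (toList x) ascX X≤q)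
  where
  fromSplit : (∃ λ X₁ → ∃ λ a → toList x ≡ X₁ ++ replicate a q × All (_< q) X₁) → KJoin (linkᴳ (Tᴳ n q) [ x ]) 1 (suc n)
  fromSplit (X₁ , a , X≡ , X₁<q) = record
    { factors = [ ms ]
    ; iso = ≃-trans (linkᴳ-Tᴳ≃SpreadBox x vx)
           (≃-trans (≃-reflexive (cong (λ X → SpreadBoxᴳ q (0 ∷ X)) X≡))
           (≃-trans (SpreadBox≃Box q X₁ a (q≥1 ∷ X₁<q))
           (≃-trans (≃-reflexive (cong Boxᴳ (sym staircase≡û)))
           (≃-trans (≃-sym (Kᴳ≃Box ms)) (≃-sym (⊕-identityʳ _))))))
    ; length≡ = refl
    ; sum≡ = trans (+-identityʳ _) sum≡
    ; positive = subst (1 ≤_) (sym sum≡) (s≤s z≤n) ∷ [] }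
    where
    û : List ℕ
    û = replicate a 0 ++ 0 ∷ X₁
    ascending-û : Ascending û
    ascending-û = ascending-++ (ascending-replicate a 0)
                    (ascending-∷ (All.tabulate (λ _ → z≤n)) (ascending-++ˡ X₁ (subst Ascending X≡ ascX)))
                    (Allₚ.replicate⁺ a (All.tabulate (λ _ → z≤n)))
    staircase-û : ∃ λ ms → staircase 0 ms ≡ û
    staircase-û = staircase-of 0 q û ascending-û (All.tabulate (λ _ → z≤n)) (Allₚ.++⁺ (Allₚ.replicate⁺ a q≥1) (q≥1 ∷ X₁<q))
    ms : List ℕ
    ms = proj₁ staircase-û
    staircase≡û : staircase 0 ms ≡ û
    staircase≡û = proj₂ staircase-û
    sum≡ : sum ms ≡ suc n
    sum≡ = begin
      sum ms                                    ≡⟨ sym (length-staircase 0 ms) ⟩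
      length (staircase 0 ms)                   ≡⟨ cong length staircase≡û ⟩
      length û                                  ≡⟨ length-++ (replicate a 0) ⟩
      length (replicate a 0) + suc (length X₁)  ≡⟨ cong (_+ suc (length X₁)) (length-replicate a) ⟩
      a + suc (length X₁)                       ≡⟨ +-suc a (length X₁) ⟩
      suc (a + length X₁)                       ≡⟨ cong suc (+-comm a (length X₁)) ⟩
      suc (length X₁ + a)                       ≡⟨ cong (λ m → suc (length X₁ + m)) (sym (length-replicate a)) ⟩
      suc (length X₁ + length (replicate a q))  ≡⟨ cong suc (sym (length-++ X₁)) ⟩
      suc (length (X₁ ++ replicate a q))        ≡⟨ cong (suc ∘ length) (sym X≡) ⟩
      suc (length (toList x))                   ≡⟨ cong suc (length-toList x) ⟩
      suc n                                     ∎
      where open ≡-Reasoning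

-- Links of faces

faceLink-KJoin : ∀ {G k} → (∀ {x} → Vtx G x → KJoin (linkᴳ G [ x ]) 1 k) →
                 ∀ c F → Unique (c ∷ F) → face (Flag G) (c ∷ F) → KJoin (linkᴳ G (c ∷ F)) (length (c ∷ F)) k
faceLink-KJoin vertexLink c []      _            (vc ∷ [] , _)    = vertexLink vc
faceLink-KJoin {G} vertexLink c (d ∷ F) (c∉dF ∷ uq) (vc ∷ vdF , adj) =
  KJoin-≃ (≃-sym (linkᴳ-∷ G (d ∷ F) c))
    (KJoin-link (faceLink-KJoin vertexLink d F uq (vdF , λ x∈ y∈ → adj (there x∈) (there y∈))) c-inLink)
  where
  c-inLink : Vtx (linkᴳ G (d ∷ F)) c
  c-inLink = vc , (λ c∈ → All.lookup c∉dF c∈ refl)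
           , All.tabulate (λ z∈ → adj (here refl) (there z∈) , adj (there z∈) (here refl))

joinAll-Kᴳs : ∀ L → Flag (Kᴳs L) ≅ joinAll (map Kσ L)
joinAll-Kᴳs L = subst (λ Ks → Flag (Kᴳs L) ≅ joinAll Ks) (sym (map-∘ L)) (≅-sym (joinAll-Flag (map Kᴳ L)))

tabulate-lookup-fromList : ∀ {a b} {A : Set a} {B : Set b} (f : A → B) L → List.tabulate (λ i → f (lookup (Vec.fromList L) i)) ≡ map f L
tabulate-lookup-fromList f []      = refl
tabulate-lookup-fromList f (x ∷ L) = cong (f x ∷_) (tabulate-lookup-fromList f L)

partitionedJoin : ∀ {K k t} L → length L ≡ t → IsPartition k (map sum L) → All (λ s → IsPartition (sum s) s) L →
                  K ≅ joinAll (map Kσ L) →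
                  Σ (Vec ℕ t) λ lam → IsPartition k (toList lam) ×
                  Σ (Fin t → List ℕ) λ σ → (∀ i → IsPartition (lookup lam i) (σ i)) ×
                  (K ≅ joinAll (map (λ i → Kσ (σ i)) (allFin t)))
partitionedJoin {K} L refl λ-partition σ-partitions K≅ =
  Vec.map sum (Vec.fromList L)
  , subst (IsPartition _) (sym (trans (toList-map sum (Vec.fromList L)) (cong (map sum) (toList∘fromList L)))) λ-partition
  , lookup (Vec.fromList L)
  , (λ i → subst (λ m → IsPartition m (lookup (Vec.fromList L) i)) (sym (lookup-map i sum (Vec.fromList L)))
                 (VecAll.lookup⁺ (VecAll.fromList⁺ σ-partitions) i))
  , subst (λ Ks → K ≅ joinAll Ks) (sym (trans (map-tabulate (λ i → i) _) (tabulate-lookup-fromList Kσ L))) K≅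

mainTheorem7 : (k q t : ℕ) → 2 ≤ k → 1 ≤ q →
               (F : List (Vec ℕ (k ∸ 1))) → Unique F → length F ≡ t → 1 ≤ t →
               face (T k q) F →
               Σ (Vec ℕ t) λ lam → IsPartition k (toList lam) ×
               Σ (Fin t → List ℕ) λ σ → (∀ i → IsPartition (lookup lam i) (σ i)) ×
               (link (T k q) F ≅ joinAll (map (λ i → Kσ (σ i)) (allFin t)))
mainTheorem7 (suc n) q t _ q≥1 []      _  refl  () _
mainTheorem7 (suc n) q t _ q≥1 (c ∷ F) uF |F|≡t _  fT
  with KJoin-normalForm (faceLink-KJoin (vertexLink-KJoin q≥1 _) c F uF (T-face⇒Flag (c ∷ F) fT))
... | L , link≃ , |L|≡|F| , λ-partition , σ-partitions =
  partitionedJoin L (trans |L|≡|F| |F|≡t) λ-partition σ-partitions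
    (≅-trans (link-T≅link-Flag q≥1 (c ∷ F))
    (≅-trans (link-Flag _ (c ∷ F) (T-face⇒Flag (c ∷ F) fT))
    (≅-trans (Flag-cong link≃) (joinAll-Kᴳs L))))
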